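{- Let $\mathcal{M}$ be a $q$-matroid of rank $k$ on an $n$-dimensional $\mathbb{F}_q$-vector space $E$, and write its Whitney function as $R_{\mathcal{M}}=\sum_{a=0}^k\sum_{c=0}^{n-k}\nu_{a,c}x^ay^c$. Then for all $\ell\in[n]_0$, $$\sum_{a=0}^k\sum_{c=0}^{n-k}\nu_{a,c}(-1)^{k+c-a-\ell}q^{\binom{k+c-a-\ell}{2}}\left[{k+c-a\atop \ell}\right]_q=\delta_{\ell,n}.$$
   Context: A $q$-matroid on $E$ is $(E,\rho)$ with $\rho$ from subspaces of $E$ to $\mathbb{N}_0$ satisfying $0\le\rho(V)\le\dim V$, monotonicity and submodularity $\rho(V+W)+\rho(V\cap W)\le\rho(V)+\rho(W)$; rank $k=\rho(E)$. Whitney function $R_{\mathcal{M}}=\sum_{V\le E}x^{k-\rho(V)}y^{\dim V-\rho(V)}$, so $\nu_{a,c}=|\{V\le E:\rho(V)=k-a,\ \dim V=k-a+c\}|$. $\left[{s\atop \ell}\right]_q$ is the Gaussian binomial (number of $\ell$-dimensional subspaces of $\mathbb{F}_q^s$, zero if $\ell>s$); $\binom{x}{2}=x(x-1)/2$; $\delta$ is the Kronecker delta; $[n]_0=\{0,\dots,n\}$. -}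

module Defs where

open import Level using (0ℓ)
open import Data.Bool using (Bool; true; false; _∧_; _∨_; if_then_else_; T)
open import Data.Nat as ℕ using (ℕ; zero; suc; _∸_; _≤_)
open import Data.Nat.DivMod using (_/_)
open import Data.Integer as ℤ using (ℤ)
open import Data.Fin using (Fin)
open import Data.Fin.Subset using (Subset; _∈_; _⊆_; _∩_; ⊤)
open import Data.List as List using (List; []; _∷_; length; map; filter; concatMap; upTo; foldr; lookup)
open import Data.Bool.ListAction using (any)
open import Data.List.Membership.Propositional renaming (_∈_ to _∈ₗ_)
open import Data.List.Relation.Unary.Unique.Propositional using (Unique)
open import Data.Vec as Vec using (Vec; []; _∷_; zipWith; replicate)
import Data.Vec.Properties as VecP
open import Relation.Binary.PropositionalEquality using (_≡_)
open import Relation.Binary.Definitions using (DecidableEquality)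
open import Relation.Nullary using (¬_; does)
open import Data.Product using (∃)
open import Algebra.Structures using (IsCommutativeRing)

record FiniteField : Set₁ where
  infixl 6 _+_
  infixl 7 _*_
  field
    K      : Set
    _+_    : K → K → K
    _*_    : K → K → K
    -_     : K → K
    0# 1#  : K
    isCommutativeRing : IsCommutativeRing _≡_ _+_ _*_ -_ 0# 1#
    0≢1    : ¬ (0# ≡ 1#)
    inverse : ∀ x → ¬ (x ≡ 0#) → ∃ λ y → x * y ≡ 1#
    _≟_    : DecidableEquality K
    elements : List K
    complete : ∀ x → x ∈ₗ elements
    unique   : Unique elements

  q : ℕ
  q = length elements

module Space (F : FiniteField) (n : ℕ) where
  open FiniteField F

  allVecs : (m : ℕ) → List (Vec K m)
  allVecs zero    = [] ∷ []
  allVecs (suc m) = concatMap (λ x → map (x ∷_) (allVecs m)) elements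

  Vect : Set
  Vect = Vec K n

  N : ℕ
  N = length (allVecs n)

  vec : Fin N → Vect
  vec i = lookup (allVecs n) i

  _⊕_ : ∀ {m} → Vec K m → Vec K m → Vec K m
  _⊕_ = zipWith _+_

  _⊙_ : ∀ {m} → K → Vec K m → Vec K m
  c ⊙ v = Vec.map (c *_) v

  0v : ∀ {m} → Vec K m
  0v = replicate _ 0#

  eqᵇ : Vect → Vect → Bool
  eqᵇ u v = does (VecP.≡-dec _≟_ u v)

  indices : List (Fin N)
  indices = List.allFin N

  -- A subset of E (as a set of vectors) is a Subset N of the indices.
  -- decidable membership of a vector
  memᵇ : Vect → Subset N → Bool
  memᵇ v V = any (λ i → Vec.lookup V i ∧ eqᵇ (vec i) v) indices

  allᵇ : ∀ {A : Set} → (A → Bool) → List A → Bool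
  allᵇ p = foldr (λ x b → p x ∧ b) true

  isSubspaceᵇ : Subset N → Bool
  isSubspaceᵇ V =
    memᵇ 0v V ∧
    allᵇ (λ i → allᵇ (λ j →
       if Vec.lookup V i ∧ Vec.lookup V j then memᵇ (vec i ⊕ vec j) V else true)
       indices) indices ∧
    allᵇ (λ c → allᵇ (λ i →
       if Vec.lookup V i then memᵇ (c ⊙ vec i) V else true) indices) elements

  IsSubspace : Subset N → Set
  IsSubspace V = T (isSubspaceᵇ V)

  _+ˢ_ : Subset N → Subset N → Subset N
  V +ˢ W = Vec.tabulate λ k →
    any (λ i → any (λ j → Vec.lookup V i ∧ Vec.lookup W j ∧ eqᵇ (vec i ⊕ vec j) (vec k))
                   indices) indices

  allSubsets : (m : ℕ) → List (Subset m)
  allSubsets zero    = [] ∷ []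
  allSubsets (suc m) = concatMap (λ s → (true ∷ s) ∷ (false ∷ s) ∷ []) (allSubsets m)

  subspaces : List (Subset N)
  subspaces = filter (λ V → T? (isSubspaceᵇ V)) (allSubsets N)
    where
    open import Relation.Nullary.Decidable using (Dec; yes; no)
    T? : (b : Bool) → Dec (T b)
    T? true  = yes _
    T? false = no (λ ())

  vecsOf : Subset N → List Vect
  vecsOf V = map vec (filter (λ i → Vec.lookup V i Data.Bool.≟ true) indices)
    where import Data.Bool

  lincomb : ∀ {m} → Vec K m → Vec Vect m → Vect
  lincomb []       []       = 0v
  lincomb (c ∷ cs) (v ∷ vs) = (c ⊙ v) ⊕ lincomb cs vs

  inSpanᵇ : List Vect → Vect → Bool
  inSpanᵇ L v = any (λ cs → eqᵇ (lincomb cs (Vec.fromList L)) v) (allVecs (length L))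

  greedyBasis : List Vect → List Vect → List Vect
  greedyBasis B []       = B
  greedyBasis B (v ∷ vs) = if inSpanᵇ B v then greedyBasis B vs
                                          else greedyBasis (B List.++ (v ∷ [])) vs

  dim : Subset N → ℕ
  dim V = length (greedyBasis [] (vecsOf V))

  E : Subset N
  E = ⊤

-- q-matroids on E = F_q^n (rank function given on all subsets of E, the
-- axioms only concern subspaces; only its values on subspaces matter).

record QMatroid (F : FiniteField) (n : ℕ) : Set where
  open Space F n
  field
    ρ : Subset N → ℕ
    ρ-le-dim : ∀ V → IsSubspace V → ρ V ≤ dim V
    ρ-mono   : ∀ V W → IsSubspace V → IsSubspace W → V ⊆ W → ρ V ≤ ρ W
    ρ-submod : ∀ V W → IsSubspace V → IsSubspace W →
               ρ (V +ˢ W) ℕ.+ ρ (V ∩ W) ≤ ρ V ℕ.+ ρ W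

  rank : ℕ
  rank = ρ E

  ν : ℕ → ℕ → ℕ
  ν a c = length (filter (λ V → (ρ V ℕ.≟ (rank ∸ a)) ×-dec (dim V ℕ.≟ ((rank ∸ a) ℕ.+ c))) subspaces)
    where open import Relation.Nullary.Decidable using (_×-dec_)

gauss : ℕ → ℕ → ℕ → ℕ
gauss q s       zero    = 1
gauss q zero    (suc ℓ) = 0
gauss q (suc s) (suc ℓ) = gauss q s ℓ ℕ.+ q ℕ.^ suc ℓ ℕ.* gauss q s (suc ℓ)

choose2 : ℕ → ℕ
choose2 x = (x ℕ.* (x ∸ 1)) / 2

sign : ℕ → ℤ
sign zero    = ℤ.+ 1
sign (suc e) = ℤ.- sign e

sumℤ : ℕ → (ℕ → ℤ) → ℤ
sumℤ m f = foldr ℤ._+_ (ℤ.+ 0) (map f (upTo (suc m)))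

-- summand (-1)^{s-ℓ} q^{binom(s-ℓ,2)} [s ; ℓ]_q with s = k+c-a; when ℓ > s the
-- Gaussian binomial vanishes, so the summand is 0
summand : ℕ → ℕ → ℕ → ℤ
summand q s ℓ with ℓ ℕ.≤? s
... | Relation.Nullary.yes _ = sign (s ∸ ℓ) ℤ.* ℤ.+ (q ℕ.^ choose2 (s ∸ ℓ) ℕ.* gauss q s ℓ)
... | Relation.Nullary.no  _ = ℤ.+ 0

δ : ℕ → ℕ → ℤ
δ i j = if does (i ℕ.≟ j) then ℤ.+ 1 else ℤ.+ 0

-- Every subspace V of E contributes to exactly one coefficient of the Whitney function,
-- namely ν_{a,c} with a = k − ρ(V) and c = dim V − ρ(V), and for it k + c − a = dim V.
-- Both indices are in range: ρ(V) ≤ k by monotonicity, and k − ρ(V) ≤ n − dim V because,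
-- by submodularity, adding one vector to a subspace raises its rank by at most one.
-- Hence the left-hand side is Σ_V f(dim V) = Σ_d N_d f(d), where
-- f(d) = (−1)^(d−ℓ) q^((d−ℓ) choose 2) [d, ℓ]_q and N_d is the number of d-dimensional
-- subspaces. Counting ordered bases in two ways gives Π_{i<d} (q^n − q^i) = N_d Π_{i<d} (q^d − q^i),
-- so N_d = [n, d]_q, and Σ_d [n, d]_q f(d) = δ_{ℓ,n} is q-binomial inversion, which follows
-- by induction on n from the q-Pascal rule.

{-# OPTIONS --safe #-}
module Submission where

open import Defs
open import Algebra.Core using (Op₂)
open import Level using (0ℓ)
open import Algebra.Bundles using (CommutativeRing; CommutativeSemigroup; Ring)
import Algebra.Properties.Group as GroupP
import Algebra.Properties.Ring as RingP
open import Algebra.Structures using (IsCommutativeMonoid; IsCommutativeSemiring; IsCommutativeRing)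
open import Data.Bool as Bool using (Bool; true; false; if_then_else_; _∧_; not; T)
import Data.Bool.Properties as Boolₚ
open import Data.Bool.ListAction using (any)
open import Data.Fin.Subset using (Subset; _∩_)
open import Data.Fin.Subset.Properties using (∈⊤)
open import Data.Empty using (⊥-elim)
open import Data.Fin using (Fin; zero; suc)
open import Data.List as List using (List; []; _∷_; _++_; map; filter; concatMap; length; upTo)
open import Data.List.Membership.Propositional using (_∈_; _∉_)
open import Data.List.Membership.Propositional.Properties using (∈-lookup; ∈-upTo⁺; ∈-upTo⁻; ∈-allFin; ∈-filter⁻; ∈-map∘filter⁻; ∈-map∘filter⁺)
open import Data.List.Relation.Unary.Any as Any using (here; there)
open import Data.List.Relation.Unary.Any.Properties using (lookup-index)
open import Data.List.Relation.Unary.AllPairs using (_∷_)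
open import Data.List.Relation.Unary.Unique.Propositional using (Unique)
open import Data.List.Relation.Unary.Unique.Propositional.Properties using (upTo⁺)
import Data.List.Relation.Unary.All as All
import Data.List.Properties as Listₚ
open import Data.Nat as ℕ using (ℕ; zero; suc; _≤_; _<_; _∸_; _^_; z≤n; s≤s)
import Data.Nat.Properties as ℕₚ
open import Data.Integer as ℤ using (ℤ)
import Data.Integer.Properties as ℤₚ
open import Data.Vec as Vec using (Vec; []; _∷_; replicate)
import Data.Vec.Properties as Vecₚ
open import Data.Vec.Relation.Binary.Pointwise.Inductive
  using (Pointwise-≡⇒≡; zipWith-assoc; zipWith-comm; zipWith-identityˡ)
open import Data.Product using (Σ; ∃; _×_; _,_; proj₁; proj₂)
open import Data.Sum using (_⊎_; inj₁; inj₂)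
open import Function using (_∘_; const)
open import Function.Bundles using (Equivalence)
open import Relation.Binary.Definitions using (DecidableEquality; tri<; tri≈; tri>)
open import Relation.Binary.PropositionalEquality
open import Relation.Nullary using (¬_; yes; no; does)
open import Relation.Nullary.Decidable using (dec-true; dec-false)
open import Relation.Unary using (Pred; Decidable)

𝟙 : Bool → ℕ
𝟙 b = if b then 1 else 0

true-ext : ∀ {a b : Bool} → (a ≡ true → b ≡ true) → (b ≡ true → a ≡ true) → a ≡ b
true-ext {true}  {true}  _   _   = refl
true-ext {false} {false} _   _   = refl
true-ext {true}  {false} a⇒b _   = sym (a⇒b refl)
true-ext {false} {true}  _   b⇒a = b⇒a refl

𝟙-mono : ∀ {a b : Bool} → (a ≡ true → b ≡ true) → 𝟙 a ≤ 𝟙 b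
𝟙-mono {false}         _   = z≤n
𝟙-mono {true}  {true}  _   = ℕₚ.≤-refl
𝟙-mono {true}  {false} a⇒b with a⇒b refl
... | ()

𝟙-injective : ∀ {a b : Bool} → 𝟙 a ≡ 𝟙 b → a ≡ b
𝟙-injective {true}  {true}  _ = refl
𝟙-injective {false} {false} _ = refl

length-concatMap-map : ∀ {X Y Z : Set} (g : X → Y → Z) (xs : List X) (ys : List Y) →
                       length (concatMap (λ x → map (g x) ys) xs) ≡ length xs ℕ.* length ys
length-concatMap-map g []       ys = refl
length-concatMap-map g (x ∷ xs) ys =
  trans (Listₚ.length-++ (map (g x) ys)) (cong₂ ℕ._+_ (Listₚ.length-map (g x) ys) (length-concatMap-map g xs ys))

any-true : ∀ {X : Set} (p : X → Bool) xs {x} → x ∈ xs → p x ≡ true → any p xs ≡ true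
any-true p (y ∷ xs) (here refl) px = cong (Bool._∨ any p xs) px
any-true p (y ∷ xs) (there x∈) px with p y
... | true  = refl
... | false = any-true p xs x∈ px

any-false : ∀ {X : Set} (p : X → Bool) xs → (∀ {x} → x ∈ xs → p x ≡ false) → any p xs ≡ false
any-false p []       _      = refl
any-false p (x ∷ xs) ¬p∈xs rewrite ¬p∈xs (here refl) = any-false p xs (¬p∈xs ∘ there)

any-witness : ∀ {X : Set} (p : X → Bool) xs → any p xs ≡ true → ∃ λ x → x ∈ xs × p x ≡ true
any-witness p (x ∷ xs) eq with p x in px
... | true  = x , here refl , px
... | false with any-witness p xs eq
...   | y , y∈xs , py = y , there y∈xs , py

1<length : ∀ {X : Set} {xs : List X} {x y} → x ∈ xs → y ∈ xs → x ≢ y → 1 < length xs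
1<length {xs = _ ∷ _ ∷ _} _           _           _   = s≤s (s≤s z≤n)
1<length {xs = _ ∷ []}    (here refl) (here refl) x≢y = ⊥-elim (x≢y refl)

module ListSum {A : Set} {_∙_ : Op₂ A} {ε : A} (isCM : IsCommutativeMonoid _≡_ _∙_ ε) where
  open IsCommutativeMonoid isCM using (assoc; identityˡ; isCommutativeSemigroup)

  private
    commutativeSemigroup : CommutativeSemigroup 0ℓ 0ℓ
    commutativeSemigroup = record { isCommutativeSemigroup = isCommutativeSemigroup }

  open import Algebra.Properties.CommutativeSemigroup commutativeSemigroup using (interchange)

  -- A fold over map, so that sumℤ m f is ∑ (upTo (suc m)) f by definition.
  ∑ : {X : Set} → List X → (X → A) → A
  ∑ xs f = List.foldr _∙_ ε (map f xs)

  module _ {X : Set} where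

    ∑-cong-∈ : ∀ (xs : List X) {f g : X → A} → (∀ {x} → x ∈ xs → f x ≡ g x) → ∑ xs f ≡ ∑ xs g
    ∑-cong-∈ []       f≡g = refl
    ∑-cong-∈ (x ∷ xs) f≡g = cong₂ _∙_ (f≡g (here refl)) (∑-cong-∈ xs (f≡g ∘ there))

    ∑-cong : ∀ (xs : List X) {f g : X → A} → f ≗ g → ∑ xs f ≡ ∑ xs g
    ∑-cong xs f≗g = ∑-cong-∈ xs (λ {x} _ → f≗g x)

    ∑-ε : ∀ (xs : List X) → ∑ xs (const ε) ≡ ε
    ∑-ε []       = refl
    ∑-ε (x ∷ xs) = trans (identityˡ _) (∑-ε xs)

    ∑-zero-∈ : ∀ (xs : List X) {f : X → A} → (∀ {x} → x ∈ xs → f x ≡ ε) → ∑ xs f ≡ ε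
    ∑-zero-∈ xs f≡ε = trans (∑-cong-∈ xs f≡ε) (∑-ε xs)

    ∑-distrib : ∀ (xs : List X) (f g : X → A) → ∑ xs (λ x → f x ∙ g x) ≡ ∑ xs f ∙ ∑ xs g
    ∑-distrib []       f g = sym (identityˡ ε)
    ∑-distrib (x ∷ xs) f g =
      trans (cong ((f x ∙ g x) ∙_) (∑-distrib xs f g)) (interchange (f x) (g x) _ _)

    ∑-++ : ∀ (xs ys : List X) (f : X → A) → ∑ (xs ++ ys) f ≡ ∑ xs f ∙ ∑ ys f
    ∑-++ []       ys f = sym (identityˡ _)
    ∑-++ (x ∷ xs) ys f = trans (cong (f x ∙_) (∑-++ xs ys f)) (sym (assoc _ _ _))

    ∑-single : ∀ {xs : List X} {f : X → A} {a} → Unique xs → a ∈ xs →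
               (∀ {x} → x ∈ xs → x ≢ a → f x ≡ ε) → ∑ xs f ≡ f a
    ∑-single {x ∷ xs} (x∉xs ∷ _) (here refl) f≡ε =
      trans (cong (_ ∙_) (∑-zero-∈ xs (λ y∈xs → f≡ε (there y∈xs) (All.lookup x∉xs y∈xs ∘ sym))))
            (IsCommutativeMonoid.identityʳ isCM _)
    ∑-single {x ∷ xs} (x∉xs ∷ unique) (there a∈xs) f≡ε =
      trans (cong₂ _∙_ (f≡ε (here refl) (All.lookup x∉xs a∈xs)) (∑-single unique a∈xs (f≡ε ∘ there)))
            (identityˡ _)

  module _ {X Y : Set} where

    ∑-comm : ∀ (xs : List X) (ys : List Y) (f : X → Y → A) →
             ∑ xs (λ x → ∑ ys (f x)) ≡ ∑ ys (λ y → ∑ xs (λ x → f x y))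
    ∑-comm []       ys f = sym (∑-ε ys)
    ∑-comm (x ∷ xs) ys f =
      trans (cong (∑ ys (f x) ∙_) (∑-comm xs ys f)) (sym (∑-distrib ys (f x) (λ y → ∑ xs (λ x → f x y))))

    ∑-map : ∀ (g : X → Y) (xs : List X) (f : Y → A) → ∑ (map g xs) f ≡ ∑ xs (f ∘ g)
    ∑-map g []       f = refl
    ∑-map g (x ∷ xs) f = cong (f (g x) ∙_) (∑-map g xs f)

    ∑-concatMap : ∀ (g : X → List Y) (xs : List X) (f : Y → A) →
                  ∑ (concatMap g xs) f ≡ ∑ xs (λ x → ∑ (g x) f)
    ∑-concatMap g []       f = refl
    ∑-concatMap g (x ∷ xs) f = trans (∑-++ (g x) (concatMap g xs) f) (cong (∑ (g x) f ∙_) (∑-concatMap g xs f))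

  ∑-upTo-suc : ∀ m (f : ℕ → A) → ∑ (upTo (suc m)) f ≡ f 0 ∙ ∑ (upTo m) (f ∘ suc)
  ∑-upTo-suc m f = cong (f 0 ∙_) (trans (cong (λ xs → ∑ xs f) (sym (Listₚ.map-upTo suc m))) (∑-map suc (upTo m) f))

  ∑-upTo-snoc : ∀ m (f : ℕ → A) → ∑ (upTo (suc m)) f ≡ ∑ (upTo m) f ∙ f m
  ∑-upTo-snoc m f = begin
    ∑ (upTo (suc m)) f         ≡⟨ cong (λ xs → ∑ xs f) (sym (Listₚ.upTo-∷ʳ m)) ⟩
    ∑ (upTo m ++ m ∷ []) f     ≡⟨ ∑-++ (upTo m) (m ∷ []) f ⟩
    ∑ (upTo m) f ∙ (f m ∙ ε)   ≡⟨ cong (∑ (upTo m) f ∙_) (IsCommutativeMonoid.identityʳ isCM (f m)) ⟩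
    ∑ (upTo m) f ∙ f m         ∎
    where open ≡-Reasoning

module SemiringSum {A : Set} {_+_ _*_ : Op₂ A} {0# 1# : A}
                   (isCS : IsCommutativeSemiring _≡_ _+_ _*_ 0# 1#) where
  open IsCommutativeSemiring isCS using (+-isCommutativeMonoid; distribʳ; zeroˡ)
  open ListSum +-isCommutativeMonoid public

  ∑-distribʳ : ∀ {X : Set} (xs : List X) (f : X → A) c → ∑ xs f * c ≡ ∑ xs (λ x → f x * c)
  ∑-distribʳ []       f c = zeroˡ c
  ∑-distribʳ (x ∷ xs) f c = trans (distribʳ c (f x) _) (cong (_+_ (f x * c)) (∑-distribʳ xs f c))

module ℕΣ = SemiringSum ℕₚ.+-*-isCommutativeSemiring
module ℤΣ = SemiringSum ℤₚ.+-*-isCommutativeSemiring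

∑-const : ∀ {X : Set} (xs : List X) c → ℕΣ.∑ xs (const c) ≡ length xs ℕ.* c
∑-const []       c = refl
∑-const (x ∷ xs) c = cong (c ℕ.+_) (∑-const xs c)

length-filter≡∑ : ∀ {X : Set} {p} {P : Pred X p} (P? : Decidable P) (xs : List X) →
                  length (filter P? xs) ≡ ℕΣ.∑ xs (𝟙 ∘ does ∘ P?)
length-filter≡∑ P? []       = refl
length-filter≡∑ P? (x ∷ xs) with does (P? x)
... | true  = cong suc (length-filter≡∑ P? xs)
... | false = length-filter≡∑ P? xs

+-∑ : ∀ {X : Set} (xs : List X) (f : X → ℕ) → ℤ.+ ℕΣ.∑ xs f ≡ ℤΣ.∑ xs (ℤ.+_ ∘ f)
+-∑ []       f = refl
+-∑ (x ∷ xs) f = trans (ℤₚ.pos-+ (f x) _) (cong (ℤ._+_ (ℤ.+ f x)) (+-∑ xs f))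

∑-by-fibres : ∀ {X : Set} (xs : List X) (g : X → ℕ) (f : ℕ → ℤ) m → (∀ {x} → x ∈ xs → g x < m) →
              ℤΣ.∑ xs (f ∘ g) ≡ ℤΣ.∑ (upTo m) (λ d → ℤ.+ length (filter (λ x → g x ℕ.≟ d) xs) ℤ.* f d)
∑-by-fibres xs g f m g<m = begin
  ℤΣ.∑ xs (f ∘ g)
    ≡⟨ ℤΣ.∑-cong-∈ xs (λ {x} x∈ → sym (as-sum x x∈)) ⟩
  ℤΣ.∑ xs (λ x → ℤΣ.∑ (upTo m) (λ d → + 𝟙 (does (g x ℕ.≟ d)) * f d))
    ≡⟨ ℤΣ.∑-comm xs (upTo m) _ ⟩
  ℤΣ.∑ (upTo m) (λ d → ℤΣ.∑ xs (λ x → + 𝟙 (does (g x ℕ.≟ d)) * f d))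
    ≡⟨ ℤΣ.∑-cong (upTo m) (sym ∘ fibre) ⟩
  ℤΣ.∑ (upTo m) (λ d → + length (filter (λ x → g x ℕ.≟ d) xs) * f d) ∎
  where
  open ≡-Reasoning
  open import Data.Integer using (+_; _*_)
  as-sum : ∀ x → x ∈ xs → ℤΣ.∑ (upTo m) (λ d → + 𝟙 (does (g x ℕ.≟ d)) * f d) ≡ f (g x)
  as-sum x x∈ = trans
    (ℤΣ.∑-single (upTo⁺ m) (∈-upTo⁺ (g<m x∈)) (λ {d} _ d≢gx → cong (λ b → + 𝟙 b * f d) (dec-false (g x ℕ.≟ d) (d≢gx ∘ sym))))
    (trans (cong (λ b → + 𝟙 b * f (g x)) (dec-true (g x ℕ.≟ g x) refl)) (ℤₚ.*-identityˡ (f (g x))))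
  fibre : ∀ d → + length (filter (λ x → g x ℕ.≟ d) xs) * f d ≡ ℤΣ.∑ xs (λ x → + 𝟙 (does (g x ℕ.≟ d)) * f d)
  fibre d = trans (cong (λ k → + k * f d) (length-filter≡∑ (λ x → g x ℕ.≟ d) xs))
                  (trans (cong (_* f d) (+-∑ xs _)) (ℤΣ.∑-distribʳ xs _ (f d)))

∑-mono-≤ : ∀ {X : Set} (xs : List X) {f g : X → ℕ} → (∀ x → f x ≤ g x) → ℕΣ.∑ xs f ≤ ℕΣ.∑ xs g
∑-mono-≤ []       f≤g = z≤n
∑-mono-≤ (x ∷ xs) f≤g = ℕₚ.+-mono-≤ (f≤g x) (∑-mono-≤ xs f≤g)

∑-≤-tight : ∀ {X : Set} (xs : List X) {f g : X → ℕ} → (∀ x → f x ≤ g x) →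
            ℕΣ.∑ xs f ≡ ℕΣ.∑ xs g → ∀ {x} → x ∈ xs → f x ≡ g x
∑-≤-tight (y ∷ xs) {f} {g} f≤g eq = tight
  where
  head≡ : f y ≡ g y
  head≡ = ℕₚ.≤-antisym (f≤g y) (ℕₚ.+-cancelʳ-≤ (ℕΣ.∑ xs g) (g y) (f y)
            (ℕₚ.≤-trans (ℕₚ.≤-reflexive (sym eq)) (ℕₚ.+-monoʳ-≤ (f y) (∑-mono-≤ xs f≤g))))
  tail≡ : ℕΣ.∑ xs f ≡ ℕΣ.∑ xs g
  tail≡ = ℕₚ.+-cancelˡ-≡ (f y) _ _ (trans eq (cong (ℕ._+ ℕΣ.∑ xs g) (sym head≡)))
  tight : ∀ {x} → x ∈ y ∷ xs → f x ≡ g x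
  tight (here refl) = head≡
  tight (there x∈)  = ∑-≤-tight xs f≤g tail≡ x∈

module Enumeration {X : Set} (_≟_ : DecidableEquality X) where

  count : X → List X → ℕ
  count x xs = ℕΣ.∑ xs (λ y → 𝟙 (does (x ≟ y)))

  Enumerates : List X → Set
  Enumerates xs = ∀ x → count x xs ≡ 1

  unique⇒count≡1 : ∀ {x xs} → Unique xs → x ∈ xs → count x xs ≡ 1
  unique⇒count≡1 {x} unique x∈xs =
    trans (ℕΣ.∑-single unique x∈xs (λ _ y≢x → cong 𝟙 (dec-false (x ≟ _) (y≢x ∘ sym))))
          (cong 𝟙 (dec-true (x ≟ x) refl))

  count>0⇒∈ : ∀ {x} xs → 0 < count x xs → x ∈ xs
  count>0⇒∈ {x} (y ∷ xs) count>0 with x ≟ y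
  ... | yes x≡y = here x≡y
  ... | no  _   = there (count>0⇒∈ xs count>0)

  ∈⇒count>0 : ∀ {x xs} → x ∈ xs → 0 < count x xs
  ∈⇒count>0 {x} {y ∷ xs} x∈ with x ≟ y | x∈
  ... | yes _ | _          = s≤s z≤n
  ... | no  _ | there x∈xs = ∈⇒count>0 x∈xs
  ... | no x≢y | here x≡y  = ⊥-elim (x≢y x≡y)

  enumerates⇒∈ : ∀ {xs} → Enumerates xs → ∀ x → x ∈ xs
  enumerates⇒∈ {xs} enum x = count>0⇒∈ xs (ℕₚ.≤-reflexive (sym (enum x)))

  count-filter : ∀ {p} {P : Pred X p} (P? : Decidable P) xs {x} → P x → count x (filter P? xs) ≡ count x xs
  count-filter P? []       px = refl
  count-filter P? (y ∷ xs) {x} px with P? y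
  ... | yes _ = cong (𝟙 (does (x ≟ y)) ℕ.+_) (count-filter P? xs px)
  ... | no ¬py with x ≟ y
  ...   | yes refl = ⊥-elim (¬py px)
  ...   | no  _    = count-filter P? xs px

  head∉tail : ∀ {y xs} → count y (y ∷ xs) ≤ 1 → y ∉ xs
  head∉tail {y} {xs} count≤1 y∈xs =
    ℕₚ.<⇒≱ (∈⇒count>0 y∈xs) (ℕₚ.≤-pred (subst (_≤ 1) (cong (λ b → 𝟙 b ℕ.+ count y xs) (dec-true (y ≟ y) refl)) count≤1))

  lookup-injective : ∀ xs → (∀ x → count x xs ≤ 1) → ∀ i j → List.lookup xs i ≡ List.lookup xs j → i ≡ j
  lookup-injective (y ∷ xs) count≤1 zero    zero    _  = refl
  lookup-injective (y ∷ xs) count≤1 zero    (suc j) eq = ⊥-elim (head∉tail (count≤1 y) (subst (_∈ xs) (sym eq) (∈-lookup j)))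
  lookup-injective (y ∷ xs) count≤1 (suc i) zero    eq = ⊥-elim (head∉tail (count≤1 y) (subst (_∈ xs) eq (∈-lookup i)))
  lookup-injective (y ∷ xs) count≤1 (suc i) (suc j) eq =
    cong suc (lookup-injective xs (λ x → ℕₚ.≤-trans (ℕₚ.m≤n+m _ _) (count≤1 x)) i j eq)

^-reflect-≤ : ∀ q → 1 < q → ∀ {a b} → q ^ a ≤ q ^ b → a ≤ b
^-reflect-≤ q 1<q q^a≤q^b = ℕₚ.≮⇒≥ (λ b<a → ℕₚ.<⇒≱ (ℕₚ.^-monoʳ-< q 1<q b<a) q^a≤q^b)

^-injective : ∀ q → 1 < q → ∀ {a b} → q ^ a ≡ q ^ b → a ≡ b
^-injective q 1<q eq = ℕₚ.≤-antisym (^-reflect-≤ q 1<q (ℕₚ.≤-reflexive eq)) (^-reflect-≤ q 1<q (ℕₚ.≤-reflexive (sym eq)))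

m+p≤n+o⇒m∸o≤n∸p : ∀ {m n o p} → o ≤ m → m ℕ.+ p ≤ n ℕ.+ o → m ∸ o ≤ n ∸ p
m+p≤n+o⇒m∸o≤n∸p {m} {n} {o} {p} o≤m m+p≤n+o = ℕₚ.m+n≤o⇒m≤o∸n (m ∸ o) (begin
  m ∸ o ℕ.+ p   ≡⟨ sym (ℕₚ.+-∸-comm p o≤m) ⟩
  m ℕ.+ p ∸ o   ≤⟨ ℕₚ.∸-monoˡ-≤ o m+p≤n+o ⟩
  n ℕ.+ o ∸ o   ≡⟨ ℕₚ.m+n∸n≡m n o ⟩
  n             ∎)
  where open ℕₚ.≤-Reasoning

k+[m∸o]∸[k∸o]≡m : ∀ {k m o} → o ≤ k → o ≤ m → k ℕ.+ (m ∸ o) ∸ (k ∸ o) ≡ m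
k+[m∸o]∸[k∸o]≡m {k} {m} {o} o≤k o≤m = begin
  k ℕ.+ (m ∸ o) ∸ (k ∸ o)   ≡⟨ ℕₚ.+-∸-comm (m ∸ o) (ℕₚ.m∸n≤m k o) ⟩
  k ∸ (k ∸ o) ℕ.+ (m ∸ o)   ≡⟨ cong (ℕ._+ (m ∸ o)) (ℕₚ.m∸[m∸n]≡n o≤k) ⟩
  o ℕ.+ (m ∸ o)             ≡⟨ ℕₚ.m+[n∸m]≡n o≤m ⟩
  m                         ∎
  where open ≡-Reasoning

gauss-above : ∀ q {m k} → m < k → gauss q m k ≡ 0
gauss-above q {zero}  {suc k} _         = refl
gauss-above q {suc m} {suc k} (s≤s m<k) =
  trans (cong₂ ℕ._+_ (gauss-above q m<k) (cong (q ^ suc k ℕ.*_) (gauss-above q (ℕₚ.m<n⇒m<1+n m<k))))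
        (ℕₚ.*-zeroʳ (q ^ suc k))

gauss-diag : ∀ q m → gauss q m m ≡ 1
gauss-diag q zero    = refl
gauss-diag q (suc m) =
  trans (cong₂ ℕ._+_ (gauss-diag q m) (cong (q ^ suc m ℕ.*_) (gauss-above q {m} ℕₚ.≤-refl)))
        (cong suc (ℕₚ.*-zeroʳ (q ^ suc m)))

-- For c = q^m this counts the linearly independent d-tuples in F_q^m.
qFalling : ℕ → ℕ → ℕ → ℕ
qFalling q c zero    = 1
qFalling q c (suc d) = qFalling q c d ℕ.* (c ∸ q ^ d)

qFalling-pos : ∀ q → 1 < q → ∀ {m d} → d ≤ m → 0 < qFalling q (q ^ m) d
qFalling-pos q 1<q {m} {zero}  _   = s≤s z≤n
qFalling-pos q 1<q {m} {suc d} d<m =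
  ℕₚ.*-mono-< (qFalling-pos q 1<q (ℕₚ.<⇒≤ d<m)) (ℕₚ.m<n⇒0<n∸m (ℕₚ.^-monoʳ-< q 1<q d<m))

module GaussianProduct (q : ℕ) .{{_ : ℕ.NonZero q}} where
  open import Data.Nat using (_+_; _*_)
  open ≡-Reasoning
  open import Data.Nat.Tactic.RingSolver using (solve-∀)
  open import Algebra.Properties.CommutativeSemigroup ℕₚ.*-commutativeSemigroup
    using () renaming (interchange to *-interchange; x∙yz≈y∙xz to *-left-comm)

  q^_∸1 : ℕ → ℕ
  q^ k ∸1 = q ^ k ∸ 1

  -- θ d = q^(d choose 2) and φ m d = ∏_{i<d} (q^(m−i) − 1).
  θ : ℕ → ℕ
  θ zero    = 1
  θ (suc d) = θ d * q ^ d

  φ : ℕ → ℕ → ℕ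
  φ m zero    = 1
  φ m (suc d) = q^ m ∸1 * φ (m ∸ 1) d

  suc-q^∸1 : ∀ k → suc (q^ k ∸1) ≡ q ^ k
  suc-q^∸1 k = ℕₚ.m+[n∸m]≡n (ℕₚ.m^n>0 q k)

  q^m∸q^i : ∀ m i → q ^ m ∸ q ^ i ≡ q ^ i * q^ (m ∸ i) ∸1
  q^m∸q^i m i with i ℕ.≤? m
  ... | yes i≤m = begin
    q ^ m ∸ q ^ i                   ≡⟨ cong (λ x → q ^ x ∸ q ^ i) (sym (ℕₚ.m+[n∸m]≡n i≤m)) ⟩
    q ^ (i + (m ∸ i)) ∸ q ^ i       ≡⟨ cong₂ _∸_ (ℕₚ.^-distribˡ-+-* q i (m ∸ i)) (sym (ℕₚ.*-identityʳ (q ^ i))) ⟩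
    q ^ i * q ^ (m ∸ i) ∸ q ^ i * 1 ≡⟨ sym (ℕₚ.*-distribˡ-∸ (q ^ i) (q ^ (m ∸ i)) 1) ⟩
    q ^ i * q^ (m ∸ i) ∸1           ∎
  ... | no i≰m = begin
    q ^ m ∸ q ^ i        ≡⟨ ℕₚ.m≤n⇒m∸n≡0 (ℕₚ.^-monoʳ-≤ q m≤i) ⟩
    0                    ≡⟨ sym (ℕₚ.*-zeroʳ (q ^ i)) ⟩
    q ^ i * 0            ≡⟨ cong (λ x → q ^ i * q^ x ∸1) (sym (ℕₚ.m≤n⇒m∸n≡0 m≤i)) ⟩
    q ^ i * q^ (m ∸ i) ∸1 ∎
    where m≤i = ℕₚ.<⇒≤ (ℕₚ.≰⇒> i≰m)

  φ-snoc : ∀ m d → φ m (suc d) ≡ φ m d * q^ (m ∸ d) ∸1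
  φ-snoc m zero    = ℕₚ.*-comm (q^ m ∸1) 1
  φ-snoc m (suc d) = begin
    q^ m ∸1 * φ (m ∸ 1) (suc d)                 ≡⟨ cong (q^ m ∸1 *_) (φ-snoc (m ∸ 1) d) ⟩
    q^ m ∸1 * (φ (m ∸ 1) d * q^ (m ∸ 1 ∸ d) ∸1) ≡⟨ sym (ℕₚ.*-assoc (q^ m ∸1) _ _) ⟩
    q^ m ∸1 * φ (m ∸ 1) d * q^ (m ∸ 1 ∸ d) ∸1   ≡⟨ cong (λ x → q^ m ∸1 * φ (m ∸ 1) d * q^ x ∸1) (ℕₚ.∸-+-assoc m 1 d) ⟩
    q^ m ∸1 * φ (m ∸ 1) d * q^ (m ∸ suc d) ∸1   ∎

  φ-above : ∀ {m d} → m < d → φ m d ≡ 0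
  φ-above {zero}  {suc d} _         = refl
  φ-above {suc m} {suc d} (s≤s m<d) = trans (cong (q^ suc m ∸1 *_) (φ-above m<d)) (ℕₚ.*-zeroʳ (q^ suc m ∸1))

  qFalling≡θ*φ : ∀ m d → qFalling q (q ^ m) d ≡ θ d * φ m d
  qFalling≡θ*φ m zero    = refl
  qFalling≡θ*φ m (suc d) = begin
    qFalling q (q ^ m) d * (q ^ m ∸ q ^ d)       ≡⟨ cong₂ _*_ (qFalling≡θ*φ m d) (q^m∸q^i m d) ⟩
    θ d * φ m d * (q ^ d * q^ (m ∸ d) ∸1)        ≡⟨ *-interchange (θ d) (φ m d) (q ^ d) (q^ (m ∸ d) ∸1) ⟩
    θ d * q ^ d * (φ m d * q^ (m ∸ d) ∸1)        ≡⟨ cong (θ d * q ^ d *_) (sym (φ-snoc m d)) ⟩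
    θ (suc d) * φ m (suc d)                      ∎

  q^∸1-split : ∀ {m d} → d ≤ m → q^ suc m ∸1 ≡ q^ suc d ∸1 + q ^ suc d * q^ (m ∸ d) ∸1
  q^∸1-split {m} {d} d≤m = ℕₚ.suc-injective (begin
    suc (q^ suc m ∸1)                         ≡⟨ suc-q^∸1 (suc m) ⟩
    q ^ suc m                                 ≡⟨ cong (λ x → q ^ suc x) (sym (ℕₚ.m+[n∸m]≡n d≤m)) ⟩
    q ^ (suc d + (m ∸ d))                     ≡⟨ ℕₚ.^-distribˡ-+-* q (suc d) (m ∸ d) ⟩
    q ^ suc d * q ^ (m ∸ d)                   ≡⟨ cong₂ _*_ (sym (suc-q^∸1 (suc d))) (sym (suc-q^∸1 (m ∸ d))) ⟩
    suc a * suc b                             ≡⟨ expand a b ⟩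
    suc (a + suc a * b)                       ≡⟨ cong (λ x → suc (a + x * b)) (suc-q^∸1 (suc d)) ⟩
    suc (a + q ^ suc d * b)                   ∎)
    where a = q^ suc d ∸1
          b = q^ (m ∸ d) ∸1
          expand : ∀ a b → suc a * suc b ≡ suc (a + suc a * b)
          expand = solve-∀

  q^∸1-split-φ : ∀ m d → (q^ suc d ∸1 + q ^ suc d * q^ (m ∸ d) ∸1) * φ m d ≡ q^ suc m ∸1 * φ m d
  q^∸1-split-φ m d with d ℕ.≤? m
  ... | yes d≤m = cong (_* φ m d) (sym (q^∸1-split d≤m))
  ... | no  d≰m = begin
    a * φ m d ≡⟨ cong (a *_) φ≡0 ⟩
    a * 0     ≡⟨ ℕₚ.*-zeroʳ a ⟩
    0         ≡⟨ sym (ℕₚ.*-zeroʳ b) ⟩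
    b * 0     ≡⟨ cong (b *_) (sym φ≡0) ⟩
    b * φ m d ∎
    where a = q^ suc d ∸1 + q ^ suc d * q^ (m ∸ d) ∸1
          b = q^ suc m ∸1
          φ≡0 = φ-above (ℕₚ.≰⇒> d≰m)

  gauss*φ : ∀ m d → gauss q m d * φ d d ≡ φ m d
  gauss*φ m       zero    = refl
  gauss*φ zero    (suc d) = refl
  gauss*φ (suc m) (suc d) = begin
    (g₀ + q ^ suc d * g₁) * (w * φ d d)
      ≡⟨ distribute g₀ g₁ (q ^ suc d) w (φ d d) ⟩
    w * (g₀ * φ d d) + q ^ suc d * (g₁ * (w * φ d d))
      ≡⟨ cong₂ (λ x y → w * x + q ^ suc d * y) (gauss*φ m d) (gauss*φ m (suc d)) ⟩
    w * φ m d + q ^ suc d * φ m (suc d)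
      ≡⟨ cong (λ x → w * φ m d + q ^ suc d * x) (φ-snoc m d) ⟩
    w * φ m d + q ^ suc d * (φ m d * q^ (m ∸ d) ∸1)
      ≡⟨ collect w (φ m d) (q ^ suc d) (q^ (m ∸ d) ∸1) ⟩
    (w + q ^ suc d * q^ (m ∸ d) ∸1) * φ m d
      ≡⟨ q^∸1-split-φ m d ⟩
    q^ suc m ∸1 * φ m d ∎
    where
    g₀ = gauss q m d
    g₁ = gauss q m (suc d)
    w  = q^ suc d ∸1
    distribute : ∀ a b c x y → (a + c * b) * (x * y) ≡ x * (a * y) + c * (b * (x * y))
    distribute = solve-∀
    collect : ∀ x y c z → x * y + c * (y * z) ≡ (x + c * z) * y
    collect = solve-∀

  gauss*qFalling : ∀ m d → gauss q m d * qFalling q (q ^ d) d ≡ qFalling q (q ^ m) d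
  gauss*qFalling m d = begin
    gauss q m d * qFalling q (q ^ d) d ≡⟨ cong (gauss q m d *_) (qFalling≡θ*φ d d) ⟩
    gauss q m d * (θ d * φ d d)        ≡⟨ *-left-comm (gauss q m d) (θ d) (φ d d) ⟩
    θ d * (gauss q m d * φ d d)        ≡⟨ cong (θ d *_) (gauss*φ m d) ⟩
    θ d * φ m d                        ≡⟨ sym (qFalling≡θ*φ m d) ⟩
    qFalling q (q ^ m) d               ∎

  gauss-unique : 1 < q → ∀ m d A → qFalling q (q ^ m) d ≡ A * qFalling q (q ^ d) d → A ≡ gauss q m d
  gauss-unique 1<q m d A eq =
    ℕₚ.*-cancelʳ-≡ A (gauss q m d) _ {{ℕ.>-nonZero (qFalling-pos q 1<q {d} ℕₚ.≤-refl)}}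
      (trans (sym eq) (sym (gauss*qFalling m d)))

choose2-suc : ∀ j → choose2 (suc j) ≡ choose2 j ℕ.+ j
choose2-suc zero    = refl
choose2-suc (suc i) = begin
  (suc (suc i) ℕ.* suc i) / 2               ≡⟨ cong (_/ 2) (expand i) ⟩
  (suc i ℕ.* i ℕ.+ suc i ℕ.* 2) / 2         ≡⟨ +-distrib-/-∣ʳ (suc i ℕ.* i) (divides (suc i) refl) ⟩
  (suc i ℕ.* i) / 2 ℕ.+ (suc i ℕ.* 2) / 2   ≡⟨ cong ((suc i ℕ.* i) / 2 ℕ.+_) (m*n/n≡m (suc i) 2) ⟩
  (suc i ℕ.* i) / 2 ℕ.+ suc i               ∎
  where
  open ≡-Reasoning
  open import Data.Nat.DivMod using (_/_; +-distrib-/-∣ʳ; m*n/n≡m)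
  open import Data.Nat.Divisibility using (divides)
  open import Data.Nat.Tactic.RingSolver using (solve-∀)
  expand : ∀ i → suc (suc i) ℕ.* suc i ≡ suc i ℕ.* i ℕ.+ suc i ℕ.* 2
  expand = solve-∀

module QBinomialInversion (q : ℕ) where
  open import Data.Integer using (+_; _+_; _*_; -_)
  open import Data.Integer.Tactic.RingSolver using (solve-∀)
  open ℤΣ using (∑)
  open ≡-Reasoning

  summand-≤ : ∀ {s ℓ} → ℓ ≤ s → summand q s ℓ ≡ sign (s ∸ ℓ) * + (q ^ choose2 (s ∸ ℓ) ℕ.* gauss q s ℓ)
  summand-≤ {s} {ℓ} ℓ≤s with ℓ ℕ.≤? s
  ... | yes _   = refl
  ... | no  ℓ≰s = ⊥-elim (ℓ≰s ℓ≤s)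

  summand-≰ : ∀ {s ℓ} → ¬ ℓ ≤ s → summand q s ℓ ≡ + 0
  summand-≰ {s} {ℓ} ℓ≰s with ℓ ℕ.≤? s
  ... | yes ℓ≤s = ⊥-elim (ℓ≰s ℓ≤s)
  ... | no  _   = refl

  coeff : ℕ → ℤ
  coeff j = sign j * + (q ^ choose2 j)

  coeff-suc : ∀ j → coeff (suc j) ≡ - (coeff j * + (q ^ j))
  coeff-suc j = begin
    - sign j * + (q ^ choose2 (suc j))           ≡⟨ cong (λ c → - sign j * + (q ^ c)) (choose2-suc j) ⟩
    - sign j * + (q ^ (choose2 j ℕ.+ j))         ≡⟨ cong (λ x → - sign j * + x) (ℕₚ.^-distribˡ-+-* q (choose2 j) j) ⟩
    - sign j * + (q ^ choose2 j ℕ.* q ^ j)       ≡⟨ cong (- sign j *_) (ℤₚ.pos-* (q ^ choose2 j) (q ^ j)) ⟩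
    - sign j * (+ (q ^ choose2 j) * + (q ^ j))   ≡⟨ regroup (sign j) (+ (q ^ choose2 j)) (+ (q ^ j)) ⟩
    - (sign j * + (q ^ choose2 j) * + (q ^ j))   ∎
    where regroup : ∀ s c x → - s * (c * x) ≡ - (s * c * x)
          regroup = solve-∀

  summand-+ : ∀ j ℓ → summand q (j ℕ.+ ℓ) ℓ ≡ coeff j * + gauss q (j ℕ.+ ℓ) ℓ
  summand-+ j ℓ = begin
    summand q (j ℕ.+ ℓ) ℓ                                        ≡⟨ summand-≤ {j ℕ.+ ℓ} (ℕₚ.m≤n+m ℓ j) ⟩
    sign (j ℕ.+ ℓ ∸ ℓ) * + (q ^ choose2 (j ℕ.+ ℓ ∸ ℓ) ℕ.* g)    ≡⟨ cong (λ i → sign i * + (q ^ choose2 i ℕ.* g)) (ℕₚ.m+n∸n≡m j ℓ) ⟩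
    sign j * + (q ^ choose2 j ℕ.* g)                             ≡⟨ cong (sign j *_) (ℤₚ.pos-* (q ^ choose2 j) g) ⟩
    sign j * (+ (q ^ choose2 j) * + g)                           ≡⟨ sym (ℤₚ.*-assoc (sign j) _ _) ⟩
    coeff j * + g                                                ∎
    where g = gauss q (j ℕ.+ ℓ) ℓ

  summand-zero : ∀ s → summand q s 0 ≡ coeff s
  summand-zero s = trans (summand-≤ {s} z≤n) (cong (λ x → sign s * + x) (ℕₚ.*-identityʳ _))

  summand-diag : ∀ s → summand q s s ≡ + 1
  summand-diag s = begin
    summand q s s                                    ≡⟨ summand-≤ {s} ℕₚ.≤-refl ⟩
    sign (s ∸ s) * + (q ^ choose2 (s ∸ s) ℕ.* gauss q s s) ≡⟨ cong (λ i → sign i * + (q ^ choose2 i ℕ.* gauss q s s)) (ℕₚ.n∸n≡0 s) ⟩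
    + 1 * + (1 ℕ.* gauss q s s)                     ≡⟨ cong (λ g → + 1 * + (1 ℕ.* g)) (gauss-diag q s) ⟩
    + 1                                              ∎

  summand↓ : ℕ → ℕ → ℤ
  summand↓ s zero    = + 0
  summand↓ s (suc ℓ) = summand q s ℓ

  summand-rec-below : ∀ j l → let e = j ℕ.+ suc l in
                      summand q (suc e) (suc l) + + (q ^ e) * summand q e (suc l) ≡ summand q e l
  summand-rec-below j l = begin
    summand q (suc e) (suc l) + + (q ^ e) * summand q e (suc l)
      ≡⟨ cong₂ (λ x y → x + + (q ^ e) * y) (summand-+ (suc j) (suc l)) (summand-+ j (suc l)) ⟩
    coeff (suc j) * + (g₀ ℕ.+ q ^ suc l ℕ.* g₁) + + (q ^ e) * (coeff j * + g₁)
      ≡⟨ cong₂ (λ x y → x * + (g₀ ℕ.+ q ^ suc l ℕ.* g₁) + y * (coeff j * + g₁))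
               (coeff-suc j) (trans (cong +_ (ℕₚ.^-distribˡ-+-* q j (suc l))) (ℤₚ.pos-* (q ^ j) (q ^ suc l))) ⟩
    - (coeff j * + (q ^ j)) * + (g₀ ℕ.+ q ^ suc l ℕ.* g₁) + + (q ^ j) * + (q ^ suc l) * (coeff j * + g₁)
      ≡⟨ cong (λ x → - (coeff j * + (q ^ j)) * x + + (q ^ j) * + (q ^ suc l) * (coeff j * + g₁)) (trans (ℤₚ.pos-+ g₀ _) (cong (_+_ (+ g₀)) (ℤₚ.pos-* (q ^ suc l) g₁))) ⟩
    - (coeff j * + (q ^ j)) * (+ g₀ + + (q ^ suc l) * + g₁) + + (q ^ j) * + (q ^ suc l) * (coeff j * + g₁)
      ≡⟨ cancel (coeff j) (+ (q ^ j)) (+ (q ^ suc l)) (+ g₀) (+ g₁) ⟩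
    - (coeff j * + (q ^ j)) * + g₀
      ≡⟨ cong (_* + g₀) (sym (coeff-suc j)) ⟩
    coeff (suc j) * + g₀
      ≡⟨ cong (λ e → coeff (suc j) * + gauss q e l) (ℕₚ.+-suc j l) ⟩
    coeff (suc j) * + gauss q (suc (j ℕ.+ l)) l
      ≡⟨ sym (summand-+ (suc j) l) ⟩
    summand q (suc (j ℕ.+ l)) l
      ≡⟨ cong (λ e → summand q e l) (sym (ℕₚ.+-suc j l)) ⟩
    summand q e l ∎
    where
    e  = j ℕ.+ suc l
    g₀ = gauss q e l
    g₁ = gauss q e (suc l)
    cancel : ∀ c x y a b → - (c * x) * (a + y * b) + x * y * (c * b) ≡ - (c * x) * a
    cancel = solve-∀

  summand-rec : ∀ e ℓ → summand q (suc e) ℓ + + (q ^ e) * summand q e ℓ ≡ summand↓ e ℓ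
  summand-rec e zero = begin
    summand q (suc e) 0 + + (q ^ e) * summand q e 0 ≡⟨ cong₂ (λ x y → x + + (q ^ e) * y) (summand-zero (suc e)) (summand-zero e) ⟩
    coeff (suc e) + + (q ^ e) * coeff e           ≡⟨ cong (_+ + (q ^ e) * coeff e) (coeff-suc e) ⟩
    - (coeff e * + (q ^ e)) + + (q ^ e) * coeff e ≡⟨ cancel (coeff e) (+ (q ^ e)) ⟩
    + 0                                           ∎
    where cancel : ∀ c x → - (c * x) + x * c ≡ + 0
          cancel = solve-∀
  summand-rec e (suc l) with ℕₚ.<-cmp l e
  ... | tri< l<e _ _ =
    subst (λ e → summand q (suc e) (suc l) + + (q ^ e) * summand q e (suc l) ≡ summand q e l)
          (ℕₚ.m∸n+n≡m l<e) (summand-rec-below (e ∸ suc l) l)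
  ... | tri≈ _ refl _ = begin
    summand q (suc l) (suc l) + + (q ^ l) * summand q l (suc l)
      ≡⟨ cong₂ (λ x y → x + + (q ^ l) * y) (summand-diag (suc l)) (summand-≰ (ℕₚ.n≮n l)) ⟩
    + 1 + + (q ^ l) * + 0 ≡⟨ cong (_+_ (+ 1)) (ℤₚ.*-zeroʳ (+ (q ^ l))) ⟩
    + 1                   ≡⟨ sym (summand-diag l) ⟩
    summand q l l         ∎
  ... | tri> _ _ e<l = begin
    summand q (suc e) (suc l) + + (q ^ e) * summand q e (suc l)
      ≡⟨ cong₂ (λ x y → x + + (q ^ e) * y) (summand-≰ (ℕₚ.<⇒≱ (s≤s e<l))) (summand-≰ (ℕₚ.<⇒≱ (ℕₚ.m<n⇒m<1+n e<l))) ⟩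
    + 0 + + (q ^ e) * + 0 ≡⟨ trans (ℤₚ.+-identityˡ _) (ℤₚ.*-zeroʳ (+ (q ^ e))) ⟩
    + 0                   ≡⟨ sym (summand-≰ (ℕₚ.<⇒≱ e<l)) ⟩
    summand q e l         ∎

  ∑-gauss-pascal : ∀ m (f : ℕ → ℤ) →
    ℤΣ.∑ (upTo (suc (suc m))) (λ d → + gauss q (suc m) d * f d)
      ≡ ℤΣ.∑ (upTo (suc m)) (λ e → + gauss q m e * (f (suc e) + + (q ^ e) * f e))
  ∑-gauss-pascal m f = begin
    ∑ (upTo (suc (suc m))) F
      ≡⟨ ℤΣ.∑-upTo-suc (suc m) F ⟩
    F 0 + ∑ (upTo (suc m)) (F ∘ suc)
      ≡⟨ cong (_+_ (F 0)) (trans (ℤΣ.∑-cong (upTo (suc m)) split) (ℤΣ.∑-distrib (upTo (suc m)) a (H ∘ suc))) ⟩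
    F 0 + (∑ (upTo (suc m)) a + ∑ (upTo (suc m)) (H ∘ suc))
      ≡⟨ +-left-comm (F 0) (∑ (upTo (suc m)) a) _ ⟩
    ∑ (upTo (suc m)) a + (H 0 + ∑ (upTo (suc m)) (H ∘ suc))
      ≡⟨ cong (_+_ (∑ (upTo (suc m)) a)) (sym (ℤΣ.∑-upTo-suc (suc m) H)) ⟩
    ∑ (upTo (suc m)) a + ∑ (upTo (suc (suc m))) H
      ≡⟨ cong (_+_ (∑ (upTo (suc m)) a)) (ℤΣ.∑-upTo-snoc (suc m) H) ⟩
    ∑ (upTo (suc m)) a + (∑ (upTo (suc m)) H + H (suc m))
      ≡⟨ cong (_+_ (∑ (upTo (suc m)) a)) (trans (cong (_+_ (∑ (upTo (suc m)) H)) H-last) (ℤₚ.+-identityʳ _)) ⟩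
    ∑ (upTo (suc m)) a + ∑ (upTo (suc m)) H
      ≡⟨ sym (ℤΣ.∑-distrib (upTo (suc m)) a H) ⟩
    ∑ (upTo (suc m)) (λ e → a e + H e)
      ≡⟨ ℤΣ.∑-cong (upTo (suc m)) combine ⟩
    ∑ (upTo (suc m)) (λ e → + gauss q m e * (f (suc e) + + (q ^ e) * f e)) ∎
    where
    open import Algebra.Properties.CommutativeSemigroup ℤₚ.+-commutativeSemigroup
      using () renaming (x∙yz≈y∙xz to +-left-comm)
    F a H : ℕ → ℤ
    F d = + gauss q (suc m) d * f d
    a e = + gauss q m e * f (suc e)
    H d = + (q ^ d ℕ.* gauss q m d) * f d
    split : ∀ e → F (suc e) ≡ a e + H (suc e)
    split e = trans (cong (_* f (suc e)) (ℤₚ.pos-+ (gauss q m e) _)) (ℤₚ.*-distribʳ-+ (f (suc e)) (+ gauss q m e) (+ (q ^ suc e ℕ.* gauss q m (suc e))))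
    H-last : H (suc m) ≡ + 0
    H-last = trans (cong (λ g → + (q ^ suc m ℕ.* g) * f (suc m)) (gauss-above q {m} ℕₚ.≤-refl))
                   (cong (_* f (suc m)) (cong +_ (ℕₚ.*-zeroʳ (q ^ suc m))))
    combine : ∀ e → a e + H e ≡ + gauss q m e * (f (suc e) + + (q ^ e) * f e)
    combine e = trans (cong (λ x → a e + x * f e) (ℤₚ.pos-* (q ^ e) (gauss q m e)))
                      (factor (+ gauss q m e) (+ (q ^ e)) (f (suc e)) (f e))
      where factor : ∀ g x u v → g * u + x * g * v ≡ g * (u + x * v)
            factor = solve-∀

  gauss-inversion : ∀ m ℓ → ℤΣ.∑ (upTo (suc m)) (λ d → + gauss q m d * summand q d ℓ) ≡ δ ℓ m
  gauss-inversion zero    zero    = refl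
  gauss-inversion zero    (suc l) = trans (ℤₚ.+-identityʳ _) (trans (ℤₚ.*-identityˡ _) (summand-≰ {0} {suc l} λ ()))
  gauss-inversion (suc m) ℓ       = begin
    ℤΣ.∑ (upTo (suc (suc m))) (λ d → + gauss q (suc m) d * summand q d ℓ)
      ≡⟨ ∑-gauss-pascal m (λ d → summand q d ℓ) ⟩
    ℤΣ.∑ (upTo (suc m)) (λ e → + gauss q m e * (summand q (suc e) ℓ + + (q ^ e) * summand q e ℓ))
      ≡⟨ ℤΣ.∑-cong (upTo (suc m)) (λ e → cong (+ gauss q m e *_) (summand-rec e ℓ)) ⟩
    ℤΣ.∑ (upTo (suc m)) (λ e → + gauss q m e * summand↓ e ℓ)
      ≡⟨ lower ℓ ⟩
    δ ℓ (suc m) ∎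
    where
    lower : ∀ ℓ → ℤΣ.∑ (upTo (suc m)) (λ e → + gauss q m e * summand↓ e ℓ) ≡ δ ℓ (suc m)
    lower zero    = ℤΣ.∑-zero-∈ (upTo (suc m)) (λ {e} _ → ℤₚ.*-zeroʳ (+ gauss q m e))
    lower (suc l) = gauss-inversion m l

module Vectors (F : FiniteField) (n : ℕ) where
  open FiniteField F
  open Space F n
  open IsCommutativeRing isCommutativeRing
    using (+-assoc; +-comm; +-identityˡ; distribˡ; distribʳ; *-assoc; *-identityˡ; zeroˡ; zeroʳ; -‿inverseʳ)
  open ≡-Reasoning

  -1# : K
  -1# = - 1#

  private
    ring : Ring _ _
    ring = CommutativeRing.ring (record { isCommutativeRing = isCommutativeRing })
    module RingProperties = RingP ring
    module GroupProperties = GroupP (Ring.+-group ring)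

  +≡0⇒≡-1* : ∀ a b → a + b ≡ 0# → a ≡ -1# * b
  +≡0⇒≡-1* a b a+b≡0 = trans (GroupProperties.inverseˡ-unique a b a+b≡0) (sym (RingProperties.-1*x≈-x b))

  +-1*≡0⇒≡ : ∀ a b → a + -1# * b ≡ 0# → a ≡ b
  +-1*≡0⇒≡ a b eq = begin
    a                  ≡⟨ +≡0⇒≡-1* a (-1# * b) eq ⟩
    -1# * (-1# * b)    ≡⟨ RingProperties.-1*x≈-x _ ⟩
    - (-1# * b)        ≡⟨ cong -_ (RingProperties.-1*x≈-x b) ⟩
    - (- b)            ≡⟨ GroupProperties.⁻¹-involutive b ⟩
    b                  ∎

  +-1*≡0 : ∀ a → a + -1# * a ≡ 0#
  +-1*≡0 a = trans (cong (_+_ a) (RingProperties.-1*x≈-x a)) (-‿inverseʳ a)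

  module _ {m : ℕ} where

    ⊕-assoc : (u v w : Vec K m) → (u ⊕ v) ⊕ w ≡ u ⊕ (v ⊕ w)
    ⊕-assoc u v w = Pointwise-≡⇒≡ (zipWith-assoc +-assoc u v w)

    ⊕-comm : (u v : Vec K m) → u ⊕ v ≡ v ⊕ u
    ⊕-comm u v = Pointwise-≡⇒≡ (zipWith-comm +-comm u v)

    ⊕-identityˡ : (v : Vec K m) → 0v ⊕ v ≡ v
    ⊕-identityˡ v = Pointwise-≡⇒≡ (zipWith-identityˡ +-identityˡ v)

    ⊕-identityʳ : (v : Vec K m) → v ⊕ 0v ≡ v
    ⊕-identityʳ v = trans (⊕-comm v 0v) (⊕-identityˡ v)

    ⊕-interchange : (a b c d : Vec K m) → (a ⊕ b) ⊕ (c ⊕ d) ≡ (a ⊕ c) ⊕ (b ⊕ d)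
    ⊕-interchange a b c d = begin
      (a ⊕ b) ⊕ (c ⊕ d) ≡⟨ ⊕-assoc a b (c ⊕ d) ⟩
      a ⊕ (b ⊕ (c ⊕ d)) ≡⟨ cong (a ⊕_) (sym (⊕-assoc b c d)) ⟩
      a ⊕ ((b ⊕ c) ⊕ d) ≡⟨ cong (λ x → a ⊕ (x ⊕ d)) (⊕-comm b c) ⟩
      a ⊕ ((c ⊕ b) ⊕ d) ≡⟨ cong (a ⊕_) (⊕-assoc c b d) ⟩
      a ⊕ (c ⊕ (b ⊕ d)) ≡⟨ sym (⊕-assoc a c (b ⊕ d)) ⟩
      (a ⊕ c) ⊕ (b ⊕ d) ∎

  ⊙-distribˡ : ∀ {m} c (u v : Vec K m) → c ⊙ (u ⊕ v) ≡ (c ⊙ u) ⊕ (c ⊙ v)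
  ⊙-distribˡ c []      []      = refl
  ⊙-distribˡ c (a ∷ u) (b ∷ v) = cong₂ _∷_ (distribˡ c a b) (⊙-distribˡ c u v)

  ⊙-distribʳ : ∀ {m} c d (v : Vec K m) → (c + d) ⊙ v ≡ (c ⊙ v) ⊕ (d ⊙ v)
  ⊙-distribʳ c d []      = refl
  ⊙-distribʳ c d (a ∷ v) = cong₂ _∷_ (distribʳ a c d) (⊙-distribʳ c d v)

  ⊙-assoc : ∀ {m} c d (v : Vec K m) → c ⊙ (d ⊙ v) ≡ (c * d) ⊙ v
  ⊙-assoc c d []      = refl
  ⊙-assoc c d (a ∷ v) = cong₂ _∷_ (sym (*-assoc c d a)) (⊙-assoc c d v)

  ⊙-identityˡ : ∀ {m} (v : Vec K m) → 1# ⊙ v ≡ v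
  ⊙-identityˡ []      = refl
  ⊙-identityˡ (a ∷ v) = cong₂ _∷_ (*-identityˡ a) (⊙-identityˡ v)

  ⊙-zeroˡ : ∀ {m} (v : Vec K m) → 0# ⊙ v ≡ 0v
  ⊙-zeroˡ []      = refl
  ⊙-zeroˡ (a ∷ v) = cong₂ _∷_ (zeroˡ a) (⊙-zeroˡ v)

  ⊙-zeroʳ : ∀ {m} c → c ⊙ 0v {m} ≡ 0v
  ⊙-zeroʳ {zero}  c = refl
  ⊙-zeroʳ {suc m} c = cong₂ _∷_ (zeroʳ c) (⊙-zeroʳ {m} c)

  ⊕-1⊙≡0v : ∀ {m} (v : Vec K m) → v ⊕ (-1# ⊙ v) ≡ 0v
  ⊕-1⊙≡0v []      = refl
  ⊕-1⊙≡0v (a ∷ v) = cong₂ _∷_ (+-1*≡0 a) (⊕-1⊙≡0v v)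

  ⊕≡0v⇒≡-1⊙ : ∀ {m} (u w : Vec K m) → u ⊕ w ≡ 0v → u ≡ -1# ⊙ w
  ⊕≡0v⇒≡-1⊙ []      []      _  = refl
  ⊕≡0v⇒≡-1⊙ (a ∷ u) (b ∷ w) eq = cong₂ _∷_ (+≡0⇒≡-1* a b (cong Vec.head eq)) (⊕≡0v⇒≡-1⊙ u w (cong Vec.tail eq))

  ⊕-1⊙≡0v⇒≡ : ∀ {m} (u w : Vec K m) → u ⊕ (-1# ⊙ w) ≡ 0v → u ≡ w
  ⊕-1⊙≡0v⇒≡ []      []      _  = refl
  ⊕-1⊙≡0v⇒≡ (a ∷ u) (b ∷ w) eq = cong₂ _∷_ (+-1*≡0⇒≡ a b (cong Vec.head eq)) (⊕-1⊙≡0v⇒≡ u w (cong Vec.tail eq))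

  lincomb-zero : ∀ {m} (ts : Vec Vect m) → lincomb (replicate m 0#) ts ≡ 0v
  lincomb-zero []       = refl
  lincomb-zero (t ∷ ts) = trans (cong₂ _⊕_ (⊙-zeroˡ t) (lincomb-zero ts)) (⊕-identityˡ 0v)

  lincomb-⊕ : ∀ {m} (cs ds : Vec K m) (ts : Vec Vect m) →
              lincomb cs ts ⊕ lincomb ds ts ≡ lincomb (cs ⊕ ds) ts
  lincomb-⊕ []       []       []       = ⊕-identityˡ 0v
  lincomb-⊕ (c ∷ cs) (d ∷ ds) (t ∷ ts) = begin
    ((c ⊙ t) ⊕ lincomb cs ts) ⊕ ((d ⊙ t) ⊕ lincomb ds ts) ≡⟨ ⊕-interchange (c ⊙ t) _ (d ⊙ t) _ ⟩
    ((c ⊙ t) ⊕ (d ⊙ t)) ⊕ (lincomb cs ts ⊕ lincomb ds ts) ≡⟨ cong₂ _⊕_ (sym (⊙-distribʳ c d t)) (lincomb-⊕ cs ds ts) ⟩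
    ((c + d) ⊙ t) ⊕ lincomb (cs ⊕ ds) ts                  ∎

  lincomb-⊙ : ∀ {m} c (cs : Vec K m) (ts : Vec Vect m) → c ⊙ lincomb cs ts ≡ lincomb (c ⊙ cs) ts
  lincomb-⊙ c []       []       = ⊙-zeroʳ c
  lincomb-⊙ c (d ∷ cs) (t ∷ ts) = begin
    c ⊙ ((d ⊙ t) ⊕ lincomb cs ts)       ≡⟨ ⊙-distribˡ c _ _ ⟩
    (c ⊙ (d ⊙ t)) ⊕ (c ⊙ lincomb cs ts) ≡⟨ cong₂ _⊕_ (⊙-assoc c d t) (lincomb-⊙ c cs ts) ⟩
    ((c * d) ⊙ t) ⊕ lincomb (c ⊙ cs) ts ∎

  module Scalars = Enumeration _≟_
  module Vecs (m : ℕ) = Enumeration (Vecₚ.≡-dec {n = m} _≟_)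

  allVecs-enumerates : ∀ m → Vecs.Enumerates m (allVecs m)
  allVecs-enumerates zero    [] = refl
  allVecs-enumerates (suc m) (a ∷ w) = begin
    Vecs.count (suc m) (a ∷ w) (allVecs (suc m))
      ≡⟨ ℕΣ.∑-concatMap (λ x → map (x ∷_) (allVecs m)) elements _ ⟩
    ℕΣ.∑ elements (λ x → ℕΣ.∑ (map (x ∷_) (allVecs m)) (λ y → 𝟙 (does (Vecₚ.≡-dec _≟_ (a ∷ w) y))))
      ≡⟨ ℕΣ.∑-cong elements (λ x → ℕΣ.∑-map (x ∷_) (allVecs m) _) ⟩
    ℕΣ.∑ elements (λ x → ℕΣ.∑ (allVecs m) (λ u → 𝟙 (does (a ≟ x) ∧ does (Vecₚ.≡-dec _≟_ w u))))
      ≡⟨ ℕΣ.∑-cong elements (λ x → count-tail (does (a ≟ x))) ⟩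
    Scalars.count a elements
      ≡⟨ Scalars.unique⇒count≡1 unique (complete a) ⟩
    1 ∎
    where
    count-tail : ∀ b → ℕΣ.∑ (allVecs m) (λ u → 𝟙 (b ∧ does (Vecₚ.≡-dec _≟_ w u))) ≡ 𝟙 b
    count-tail true  = allVecs-enumerates m w
    count-tail false = ℕΣ.∑-ε (allVecs m)

  length-allVecs : ∀ m → length (allVecs m) ≡ q ^ m
  length-allVecs zero    = refl
  length-allVecs (suc m) =
    trans (length-concatMap-map _∷_ elements (allVecs m)) (cong (q ℕ.*_) (length-allVecs m))

  1<q : 1 < q
  1<q = 1<length (complete 0#) (complete 1#) 0≢1

  vec∈ : ∀ v → v ∈ allVecs n
  vec∈ = Vecs.enumerates⇒∈ n (allVecs-enumerates n)

  idx : Vect → Fin N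
  idx v = Any.index (vec∈ v)

  vec∘idx : ∀ v → vec (idx v) ≡ v
  vec∘idx v = sym (lookup-index (vec∈ v))

  idx∘vec : ∀ i → idx (vec i) ≡ i
  idx∘vec i = Vecs.lookup-injective n (allVecs n) (λ x → ℕₚ.≤-reflexive (allVecs-enumerates n x)) _ _ (vec∘idx (vec i))

  χ : Subset N → Vect → Bool
  χ S v = Vec.lookup S (idx v)

  χ-vec : ∀ S i → χ S (vec i) ≡ Vec.lookup S i
  χ-vec S i = cong (Vec.lookup S) (idx∘vec i)

  subset-ext : ∀ S T → (∀ v → χ S v ≡ χ T v) → S ≡ T
  subset-ext S T χS≡χT = begin
    S                           ≡⟨ sym (Vecₚ.tabulate∘lookup S) ⟩
    Vec.tabulate (Vec.lookup S) ≡⟨ Vecₚ.tabulate-cong (λ i → trans (sym (χ-vec S i)) (trans (χS≡χT (vec i)) (χ-vec T i))) ⟩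
    Vec.tabulate (Vec.lookup T) ≡⟨ Vecₚ.tabulate∘lookup T ⟩
    T                           ∎

  fromPred : (Vect → Bool) → Subset N
  fromPred p = Vec.tabulate (p ∘ vec)

  χ-fromPred : ∀ p v → χ (fromPred p) v ≡ p v
  χ-fromPred p v = trans (Vecₚ.lookup∘tabulate _ (idx v)) (cong p (vec∘idx v))

  eqᵇ-refl : ∀ v → eqᵇ v v ≡ true
  eqᵇ-refl v = dec-true (Vecₚ.≡-dec _≟_ v v) refl

  eqᵇ⇒≡ : ∀ u v → eqᵇ u v ≡ true → u ≡ v
  eqᵇ⇒≡ u v eq with Vecₚ.≡-dec _≟_ u v
  ... | yes u≡v = u≡v

  memᵇ≡χ : ∀ v V → memᵇ v V ≡ χ V v
  memᵇ≡χ v V with χ V v in χVv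
  ... | true  = any-true _ indices (∈-allFin (idx v)) (trans (cong₂ _∧_ χVv (cong (λ w → eqᵇ w v) (vec∘idx v))) (eqᵇ-refl v))
  ... | false = any-false _ indices (λ {i} _ → at i)
    where
    at : ∀ i → (Vec.lookup V i ∧ eqᵇ (vec i) v) ≡ false
    at i with eqᵇ (vec i) v in eq
    ... | false = Boolₚ.∧-zeroʳ _
    ... | true  = trans (Boolₚ.∧-identityʳ _) (trans (sym (χ-vec V i)) (trans (cong (χ V) (eqᵇ⇒≡ _ _ eq)) χVv))

  card : Subset N → ℕ
  card S = ℕΣ.∑ (allVecs n) (𝟙 ∘ χ S)

module Subspaces (F : FiniteField) (n : ℕ) where
  open FiniteField F
  open Space F n
  open Vectors F n
  open IsCommutativeRing isCommutativeRing using (*-comm)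
  open ≡-Reasoning

  allᵇ⇒ : ∀ {A : Set} (p : A → Bool) xs {x} → allᵇ p xs ≡ true → x ∈ xs → p x ≡ true
  allᵇ⇒ p (y ∷ xs) all (here refl) = Boolₚ.∧-conicalˡ (p y) _ all
  allᵇ⇒ p (y ∷ xs) all (there x∈)  = allᵇ⇒ p xs (Boolₚ.∧-conicalʳ (p y) _ all) x∈

  ⇒allᵇ : ∀ {A : Set} (p : A → Bool) xs → (∀ x → p x ≡ true) → allᵇ p xs ≡ true
  ⇒allᵇ p []       _   = refl
  ⇒allᵇ p (y ∷ xs) all = cong₂ _∧_ (all y) (⇒allᵇ p xs all)

  record LinearlyClosed (P : Vect → Bool) : Set where
    field
      zero-closed : P 0v ≡ true
      ⊕-closed    : ∀ u w → P u ≡ true → P w ≡ true → P (u ⊕ w) ≡ true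
      ⊙-closed    : ∀ c u → P u ≡ true → P (c ⊙ u) ≡ true
  open LinearlyClosed

  linearlyClosed-cong : ∀ {P Q : Vect → Bool} → P ≗ Q → LinearlyClosed P → LinearlyClosed Q
  linearlyClosed-cong P≗Q closed = record
    { zero-closed = trans (sym (P≗Q 0v)) (zero-closed closed)
    ; ⊕-closed    = λ u w Pu Pw → trans (sym (P≗Q _)) (⊕-closed closed u w (trans (P≗Q u) Pu) (trans (P≗Q w) Pw))
    ; ⊙-closed    = λ c u Pu → trans (sym (P≗Q _)) (⊙-closed closed c u (trans (P≗Q u) Pu))
    }

  private
    ⊕-testᵇ : Subset N → Fin N → Fin N → Bool
    ⊕-testᵇ V i j = if Vec.lookup V i ∧ Vec.lookup V j then memᵇ (vec i ⊕ vec j) V else true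

    ⊙-testᵇ : Subset N → K → Fin N → Bool
    ⊙-testᵇ V c i = if Vec.lookup V i then memᵇ (c ⊙ vec i) V else true

  isSubspace⇒closed : ∀ V → IsSubspace V → LinearlyClosed (χ V)
  isSubspace⇒closed V isV = record
    { zero-closed = trans (sym (memᵇ≡χ 0v V)) (Boolₚ.∧-conicalˡ _ _ isVᵇ)
    ; ⊕-closed    = λ u w Vu Vw → trans (sym (memᵇ≡χ _ V))
        (subst₂ (λ x y → memᵇ (x ⊕ y) V ≡ true) (vec∘idx u) (vec∘idx w)
          (if-true (cong₂ _∧_ Vu Vw)
            (allᵇ⇒ (⊕-testᵇ V (idx u)) indices (allᵇ⇒ (λ i → allᵇ (⊕-testᵇ V i) indices) indices ⊕-tests (∈-allFin (idx u))) (∈-allFin (idx w)))))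
    ; ⊙-closed    = λ c u Vu → trans (sym (memᵇ≡χ _ V))
        (subst (λ x → memᵇ (c ⊙ x) V ≡ true) (vec∘idx u)
          (if-true Vu (allᵇ⇒ (⊙-testᵇ V c) indices (allᵇ⇒ (λ c → allᵇ (⊙-testᵇ V c) indices) elements ⊙-tests (complete c)) (∈-allFin (idx u)))))
    }
    where
    isVᵇ = Equivalence.to Boolₚ.T-≡ isV
    rest = Boolₚ.∧-conicalʳ (memᵇ 0v V) _ isVᵇ
    ⊕-tests = Boolₚ.∧-conicalˡ _ _ rest
    ⊙-tests = Boolₚ.∧-conicalʳ _ _ rest
    if-true : ∀ {b x} → b ≡ true → (if b then x else true) ≡ true → x ≡ true
    if-true refl x≡true = x≡true

  closed⇒isSubspace : ∀ V → LinearlyClosed (χ V) → IsSubspace V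
  closed⇒isSubspace V closed = Equivalence.from Boolₚ.T-≡
    (cong₂ _∧_ (trans (memᵇ≡χ 0v V) (zero-closed closed))
      (cong₂ _∧_ (⇒allᵇ _ indices (λ i → ⇒allᵇ _ indices (⊕-test-holds i)))
                 (⇒allᵇ _ elements (λ c → ⇒allᵇ _ indices (⊙-test-holds c)))))
    where
    ⊕-test-holds : ∀ i j → ⊕-testᵇ V i j ≡ true
    ⊕-test-holds i j with Vec.lookup V i in Vi | Vec.lookup V j in Vj
    ... | true  | true  = trans (memᵇ≡χ _ V) (⊕-closed closed _ _ (trans (χ-vec V i) Vi) (trans (χ-vec V j) Vj))
    ... | true  | false = refl
    ... | false | _     = refl
    ⊙-test-holds : ∀ c i → ⊙-testᵇ V c i ≡ true
    ⊙-test-holds c i with Vec.lookup V i in Vi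
    ... | true  = trans (memᵇ≡χ _ V) (⊙-closed closed _ _ (trans (χ-vec V i) Vi))
    ... | false = refl

  inSpan : ∀ {m} → Vec Vect m → Vect → Bool
  inSpan {m} ts v = any (λ cs → eqᵇ (lincomb cs ts) v) (allVecs m)

  lincomb∈span : ∀ {m} (ts : Vec Vect m) {v} cs → lincomb cs ts ≡ v → inSpan ts v ≡ true
  lincomb∈span {m} ts cs refl =
    any-true _ (allVecs m) (Vecs.enumerates⇒∈ m (allVecs-enumerates m) cs) (eqᵇ-refl (lincomb cs ts))

  span⇒lincomb : ∀ {m} (ts : Vec Vect m) v → inSpan ts v ≡ true → ∃ λ cs → lincomb cs ts ≡ v
  span⇒lincomb {m} ts v v∈ with any-witness _ (allVecs m) v∈
  ... | cs , _ , eq = cs , eqᵇ⇒≡ _ _ eq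

  span-closed : ∀ {m} (ts : Vec Vect m) → LinearlyClosed (inSpan ts)
  span-closed {m} ts = record
    { zero-closed = lincomb∈span ts (replicate m 0#) (lincomb-zero ts)
    ; ⊕-closed    = λ u w u∈ w∈ → let (cs , u≡) = span⇒lincomb ts u u∈; (ds , w≡) = span⇒lincomb ts w w∈ in
        lincomb∈span ts (cs ⊕ ds) (trans (sym (lincomb-⊕ cs ds ts)) (cong₂ _⊕_ u≡ w≡))
    ; ⊙-closed    = λ c u u∈ → let (cs , u≡) = span⇒lincomb ts u u∈ in
        lincomb∈span ts (c ⊙ cs) (trans (sym (lincomb-⊙ c cs ts)) (cong (c ⊙_) u≡))
    }

  span : ∀ {m} → Vec Vect m → Subset N
  span ts = fromPred (inSpan ts)

  χ-span : ∀ {m} (ts : Vec Vect m) v → χ (span ts) v ≡ inSpan ts v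
  χ-span ts = χ-fromPred (inSpan ts)

  span-isSubspace : ∀ {m} (ts : Vec Vect m) → IsSubspace (span ts)
  span-isSubspace ts = closed⇒isSubspace (span ts) (linearlyClosed-cong (sym ∘ χ-span ts) (span-closed ts))

  AllIn : ∀ {m} → (Vect → Bool) → Vec Vect m → Bool
  AllIn P []       = true
  AllIn P (t ∷ ts) = P t ∧ AllIn P ts

  AllIn-mono : ∀ {P Q : Vect → Bool} → (∀ v → P v ≡ true → Q v ≡ true) →
               ∀ {m} (ts : Vec Vect m) → AllIn P ts ≡ true → AllIn Q ts ≡ true
  AllIn-mono P⊆Q []       _   = refl
  AllIn-mono P⊆Q (t ∷ ts) all = cong₂ _∧_ (P⊆Q t (Boolₚ.∧-conicalˡ _ _ all)) (AllIn-mono P⊆Q ts (Boolₚ.∧-conicalʳ _ _ all))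

  AllIn-const : ∀ {P : Vect → Bool} → (∀ v → P v ≡ true) → ∀ {m} (ts : Vec Vect m) → AllIn P ts ≡ true
  AllIn-const all []       = refl
  AllIn-const all (t ∷ ts) = cong₂ _∧_ (all t) (AllIn-const all ts)

  lincomb-closed : ∀ {P} → LinearlyClosed P → ∀ {m} (cs : Vec K m) ts → AllIn P ts ≡ true → P (lincomb cs ts) ≡ true
  lincomb-closed closed []       []       _   = zero-closed closed
  lincomb-closed closed (c ∷ cs) (t ∷ ts) all =
    ⊕-closed closed _ _ (⊙-closed closed c t (Boolₚ.∧-conicalˡ _ _ all)) (lincomb-closed closed cs ts (Boolₚ.∧-conicalʳ _ _ all))

  span-minimal : ∀ {P} → LinearlyClosed P → ∀ {m} (ts : Vec Vect m) → AllIn P ts ≡ true →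
                 ∀ v → inSpan ts v ≡ true → P v ≡ true
  span-minimal closed ts all v v∈ with span⇒lincomb ts v v∈
  ... | cs , refl = lincomb-closed closed cs ts all

  inSpan-∷ : ∀ {m} t (ts : Vec Vect m) v → inSpan ts v ≡ true → inSpan (t ∷ ts) v ≡ true
  inSpan-∷ t ts v v∈ with span⇒lincomb ts v v∈
  ... | cs , refl = lincomb∈span (t ∷ ts) (0# ∷ cs) (trans (cong (_⊕ lincomb cs ts) (⊙-zeroˡ t)) (⊕-identityˡ _))

  head∈span : ∀ {m} t (ts : Vec Vect m) → inSpan (t ∷ ts) t ≡ true
  head∈span {m} t ts =
    lincomb∈span (t ∷ ts) (1# ∷ replicate m 0#) (trans (cong₂ _⊕_ (⊙-identityˡ t) (lincomb-zero ts)) (⊕-identityʳ t))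

  AllIn-span : ∀ {m} (ts : Vec Vect m) → AllIn (inSpan ts) ts ≡ true
  AllIn-span []       = refl
  AllIn-span (t ∷ ts) = cong₂ _∧_ (head∈span t ts) (AllIn-mono (inSpan-∷ t ts) ts (AllIn-span ts))

  Independent : ∀ {m} → Vec Vect m → Set
  Independent {m} ts = ∀ cs → lincomb cs ts ≡ 0v → cs ≡ replicate m 0#

  independent-[] : Independent []
  independent-[] [] _ = refl

  independent⇒lincomb-injective : ∀ {m} (ts : Vec Vect m) → Independent ts →
                                  ∀ cs ds → lincomb cs ts ≡ lincomb ds ts → cs ≡ ds
  independent⇒lincomb-injective ts indep cs ds eq = ⊕-1⊙≡0v⇒≡ cs ds (indep _ (begin
    lincomb (cs ⊕ (-1# ⊙ ds)) ts           ≡⟨ sym (lincomb-⊕ cs _ ts) ⟩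
    lincomb cs ts ⊕ lincomb (-1# ⊙ ds) ts  ≡⟨ cong (lincomb cs ts ⊕_) (sym (lincomb-⊙ -1# ds ts)) ⟩
    lincomb cs ts ⊕ (-1# ⊙ lincomb ds ts)  ≡⟨ cong (λ x → lincomb cs ts ⊕ (-1# ⊙ x)) (sym eq) ⟩
    lincomb cs ts ⊕ (-1# ⊙ lincomb cs ts)  ≡⟨ ⊕-1⊙≡0v _ ⟩
    0v                                     ∎))

  independent-∷ : ∀ {m} t (ts : Vec Vect m) → Independent ts → inSpan ts t ≡ false → Independent (t ∷ ts)
  independent-∷ t ts indep t∉ (c ∷ cs) eq with c ≟ 0#
  ... | yes refl = cong (0# ∷_) (indep cs (trans (sym (trans (cong (_⊕ lincomb cs ts) (⊙-zeroˡ t)) (⊕-identityˡ _))) eq))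
  ... | no c≢0 with inverse c c≢0
  ...   | c⁻¹ , cc⁻¹≡1 = ⊥-elim (Boolₚ.not-¬ t∉ (lincomb∈span ts (c⁻¹ ⊙ (-1# ⊙ cs)) (begin
    lincomb (c⁻¹ ⊙ (-1# ⊙ cs)) ts  ≡⟨ sym (lincomb-⊙ c⁻¹ (-1# ⊙ cs) ts) ⟩
    c⁻¹ ⊙ lincomb (-1# ⊙ cs) ts    ≡⟨ cong (c⁻¹ ⊙_) (sym (lincomb-⊙ -1# cs ts)) ⟩
    c⁻¹ ⊙ (-1# ⊙ lincomb cs ts)    ≡⟨ cong (c⁻¹ ⊙_) (sym (⊕≡0v⇒≡-1⊙ (c ⊙ t) _ eq)) ⟩
    c⁻¹ ⊙ (c ⊙ t)                  ≡⟨ ⊙-assoc c⁻¹ c t ⟩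
    (c⁻¹ * c) ⊙ t                  ≡⟨ cong (_⊙ t) (trans (*-comm c⁻¹ c) cc⁻¹≡1) ⟩
    1# ⊙ t                         ≡⟨ ⊙-identityˡ t ⟩
    t                              ∎)))

  card-span : ∀ {m} (ts : Vec Vect m) → Independent ts → card (span ts) ≡ q ^ m
  card-span {m} ts indep = begin
    card (span ts)
      ≡⟨ ℕΣ.∑-cong (allVecs n) (λ v → cong 𝟙 (χ-span ts v)) ⟩
    ℕΣ.∑ (allVecs n) (λ v → 𝟙 (inSpan ts v))
      ≡⟨ ℕΣ.∑-cong (allVecs n) preimages ⟩
    ℕΣ.∑ (allVecs n) (λ v → ℕΣ.∑ (allVecs m) (λ cs → 𝟙 (eqᵇ (lincomb cs ts) v)))
      ≡⟨ ℕΣ.∑-comm (allVecs n) (allVecs m) _ ⟩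
    ℕΣ.∑ (allVecs m) (λ cs → Vecs.count n (lincomb cs ts) (allVecs n))
      ≡⟨ ℕΣ.∑-cong (allVecs m) (λ cs → allVecs-enumerates n (lincomb cs ts)) ⟩
    ℕΣ.∑ (allVecs m) (const 1)
      ≡⟨ trans (∑-const (allVecs m) 1) (ℕₚ.*-identityʳ _) ⟩
    length (allVecs m)
      ≡⟨ length-allVecs m ⟩
    q ^ m ∎
    where
    preimages : ∀ v → 𝟙 (inSpan ts v) ≡ ℕΣ.∑ (allVecs m) (λ cs → 𝟙 (eqᵇ (lincomb cs ts) v))
    preimages v with inSpan ts v in v∈?
    ... | true with span⇒lincomb ts v v∈?
    ...   | cs₀ , refl = sym (trans (ℕΣ.∑-cong (allVecs m) (cong 𝟙 ∘ same-coefficients)) (allVecs-enumerates m cs₀))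
      where
      same-coefficients : ∀ cs → eqᵇ (lincomb cs ts) (lincomb cs₀ ts) ≡ does (Vecₚ.≡-dec _≟_ cs₀ cs)
      same-coefficients cs with Vecₚ.≡-dec _≟_ cs₀ cs
      ... | yes refl = eqᵇ-refl (lincomb cs ts)
      ... | no cs₀≢cs = Boolₚ.¬-not (λ eq → cs₀≢cs (sym (independent⇒lincomb-injective ts indep cs cs₀ (eqᵇ⇒≡ _ _ eq))))
    preimages v | false =
      sym (ℕΣ.∑-zero-∈ (allVecs m) (λ {cs} _ → cong 𝟙 (Boolₚ.¬-not (λ eq → Boolₚ.not-¬ v∈? (lincomb∈span ts cs (eqᵇ⇒≡ _ _ eq))))))

  AllIn-snoc⁺ : ∀ {P} (B : List Vect) v → AllIn P (v ∷ Vec.fromList B) ≡ true → AllIn P (Vec.fromList (B ++ v ∷ [])) ≡ true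
  AllIn-snoc⁺         []      v all = all
  AllIn-snoc⁺ {P} (b ∷ B) v all = cong₂ _∧_ (Boolₚ.∧-conicalˡ (P b) _ rest)
    (AllIn-snoc⁺ B v (cong₂ _∧_ (Boolₚ.∧-conicalˡ (P v) _ all) (Boolₚ.∧-conicalʳ (P b) _ rest)))
    where rest = Boolₚ.∧-conicalʳ (P v) _ all

  AllIn-snoc⁻ : ∀ {P} (B : List Vect) v → AllIn P (Vec.fromList (B ++ v ∷ [])) ≡ true → AllIn P (v ∷ Vec.fromList B) ≡ true
  AllIn-snoc⁻         []      v all = all
  AllIn-snoc⁻ {P} (b ∷ B) v all = cong₂ _∧_ (Boolₚ.∧-conicalˡ (P v) _ rest)
    (cong₂ _∧_ (Boolₚ.∧-conicalˡ (P b) _ all) (Boolₚ.∧-conicalʳ (P v) _ rest))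
    where rest = AllIn-snoc⁻ B v (Boolₚ.∧-conicalʳ (P b) _ all)

  span-∷⊆span-snoc : ∀ B v w → inSpan (v ∷ Vec.fromList B) w ≡ true → inSpan (Vec.fromList (B ++ v ∷ [])) w ≡ true
  span-∷⊆span-snoc B v = span-minimal (span-closed (Vec.fromList (B ++ v ∷ []))) (v ∷ Vec.fromList B)
    (AllIn-snoc⁻ B v (AllIn-span (Vec.fromList (B ++ v ∷ []))))

  -- greedyBasis appends new vectors at the end, whereas independent-∷ adds them at the front.
  rotate : ∀ (B : List Vect) v → Vec K (length (B ++ v ∷ [])) → Vec K (suc (length B))
  rotate []      v (c ∷ []) = c ∷ []
  rotate (b ∷ B) v (c ∷ cs) with rotate B v cs
  ... | d ∷ ds = d ∷ c ∷ ds

  lincomb-rotate : ∀ B v cs → lincomb cs (Vec.fromList (B ++ v ∷ [])) ≡ lincomb (rotate B v cs) (v ∷ Vec.fromList B)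
  lincomb-rotate []      v (c ∷ []) = refl
  lincomb-rotate (b ∷ B) v (c ∷ cs) with rotate B v cs | lincomb-rotate B v cs
  ... | d ∷ ds | eq = begin
    (c ⊙ b) ⊕ lincomb cs (Vec.fromList (B ++ v ∷ [])) ≡⟨ cong ((c ⊙ b) ⊕_) eq ⟩
    (c ⊙ b) ⊕ ((d ⊙ v) ⊕ lincomb ds (Vec.fromList B)) ≡⟨ sym (⊕-assoc _ _ _) ⟩
    ((c ⊙ b) ⊕ (d ⊙ v)) ⊕ lincomb ds (Vec.fromList B) ≡⟨ cong (_⊕ lincomb ds (Vec.fromList B)) (⊕-comm _ _) ⟩
    ((d ⊙ v) ⊕ (c ⊙ b)) ⊕ lincomb ds (Vec.fromList B) ≡⟨ ⊕-assoc _ _ _ ⟩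
    (d ⊙ v) ⊕ ((c ⊙ b) ⊕ lincomb ds (Vec.fromList B)) ∎

  rotate≡0⇒≡0 : ∀ B v cs → rotate B v cs ≡ replicate _ 0# → cs ≡ replicate _ 0#
  rotate≡0⇒≡0 []      v (c ∷ []) eq = eq
  rotate≡0⇒≡0 (b ∷ B) v (c ∷ cs) eq with rotate B v cs | rotate≡0⇒≡0 B v cs
  rotate≡0⇒≡0 (b ∷ B) v (c ∷ cs) refl | _ ∷ _ | ih = cong (0# ∷_) (ih refl)

  independent-snoc : ∀ (B : List Vect) v → Independent (v ∷ Vec.fromList B) → Independent (Vec.fromList (B ++ v ∷ []))
  independent-snoc B v indep cs eq = rotate≡0⇒≡0 B v cs (indep (rotate B v cs) (trans (sym (lincomb-rotate B v cs)) eq))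

  record GreedyInvariant (P : Vect → Bool) (B : List Vect) : Set where
    field
      independent : Independent (Vec.fromList B)
      inside      : AllIn P (Vec.fromList B) ≡ true
  open GreedyInvariant

  greedyBasis-invariant : ∀ {P} (B vs : List Vect) → GreedyInvariant P B → (∀ {x} → x ∈ vs → P x ≡ true) →
                          GreedyInvariant P (greedyBasis B vs)
  greedyBasis-invariant B []       inv _    = inv
  greedyBasis-invariant B (v ∷ vs) inv vs⊆P with inSpanᵇ B v in v∈?
  ... | true  = greedyBasis-invariant B vs inv (vs⊆P ∘ there)
  ... | false = greedyBasis-invariant (B ++ v ∷ []) vs inv′ (vs⊆P ∘ there)
    where
    inv′ = record
      { independent = independent-snoc B v (independent-∷ v (Vec.fromList B) (independent inv) v∈?)
      ; inside      = AllIn-snoc⁺ B v (cong₂ _∧_ (vs⊆P (here refl)) (inside inv))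
      }

  greedyBasis-extends : ∀ (B vs : List Vect) w → inSpan (Vec.fromList B) w ≡ true → inSpan (Vec.fromList (greedyBasis B vs)) w ≡ true
  greedyBasis-extends B []       w w∈ = w∈
  greedyBasis-extends B (v ∷ vs) w w∈ with inSpanᵇ B v
  ... | true  = greedyBasis-extends B vs w w∈
  ... | false = greedyBasis-extends (B ++ v ∷ []) vs w (span-∷⊆span-snoc B v w (inSpan-∷ v (Vec.fromList B) w w∈))

  greedyBasis-covers : ∀ (B vs : List Vect) {w} → w ∈ vs → inSpan (Vec.fromList (greedyBasis B vs)) w ≡ true
  greedyBasis-covers B (v ∷ vs) (here refl) with inSpanᵇ B v in v∈?
  ... | true  = greedyBasis-extends B vs v v∈?
  ... | false = greedyBasis-extends (B ++ v ∷ []) vs v (span-∷⊆span-snoc B v v (head∈span v (Vec.fromList B)))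
  greedyBasis-covers B (v ∷ vs) (there w∈) with inSpanᵇ B v
  ... | true  = greedyBasis-covers B vs w∈
  ... | false = greedyBasis-covers (B ++ v ∷ []) vs w∈

  vecsOf⇒χ : ∀ V {x} → x ∈ vecsOf V → χ V x ≡ true
  vecsOf⇒χ V x∈ with ∈-map∘filter⁻ vec (λ i → Vec.lookup V i Bool.≟ true) {xs = indices} x∈
  ... | i , _ , refl , Vi = trans (χ-vec V i) Vi

  χ⇒vecsOf : ∀ V x → χ V x ≡ true → x ∈ vecsOf V
  χ⇒vecsOf V x Vx = ∈-map∘filter⁺ vec (λ i → Vec.lookup V i Bool.≟ true) (idx x , ∈-allFin (idx x) , sym (vec∘idx x) , Vx)

  basis : Subset N → List Vect
  basis V = greedyBasis [] (vecsOf V)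

  basis-invariant : ∀ V → GreedyInvariant (χ V) (basis V)
  basis-invariant V = greedyBasis-invariant [] (vecsOf V) (record { independent = independent-[] ; inside = refl }) (vecsOf⇒χ V)

  span-basis : ∀ V → IsSubspace V → span (Vec.fromList (basis V)) ≡ V
  span-basis V isV = subset-ext _ _ (λ v → trans (χ-span (Vec.fromList (basis V)) v) (true-ext
    (span-minimal (isSubspace⇒closed V isV) (Vec.fromList (basis V)) (inside (basis-invariant V)) v)
    (greedyBasis-covers [] (vecsOf V) ∘ χ⇒vecsOf V v)))

  card-subspace : ∀ V → IsSubspace V → card V ≡ q ^ dim V
  card-subspace V isV = trans (cong card (sym (span-basis V isV))) (card-span _ (independent (basis-invariant V)))

  dim-span : ∀ {m} (ts : Vec Vect m) → Independent ts → dim (span ts) ≡ m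
  dim-span ts indep = ^-injective q 1<q (trans (sym (card-subspace (span ts) (span-isSubspace ts))) (card-span ts indep))

  card≤q^n : ∀ V → card V ≤ q ^ n
  card≤q^n V = ℕₚ.≤-trans (∑-mono-≤ (allVecs n) (λ v → 𝟙-mono {χ V v} {true} (const refl)))
                          (ℕₚ.≤-reflexive (trans (trans (∑-const (allVecs n) 1) (ℕₚ.*-identityʳ _)) (length-allVecs n)))

  dim≤n : ∀ V → IsSubspace V → dim V ≤ n
  dim≤n V isV = ^-reflect-≤ q 1<q (ℕₚ.≤-trans (ℕₚ.≤-reflexive (sym (card-subspace V isV))) (card≤q^n V))

  χ-E : ∀ v → χ E v ≡ true
  χ-E v = Vecₚ.lookup-replicate (idx v) true

  E-isSubspace : IsSubspace E
  E-isSubspace = closed⇒isSubspace E (record { zero-closed = χ-E _ ; ⊕-closed = λ _ _ _ _ → χ-E _ ; ⊙-closed = λ _ _ _ → χ-E _ })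

  card-E : card E ≡ q ^ n
  card-E = trans (ℕΣ.∑-cong (allVecs n) (cong 𝟙 ∘ χ-E))
                 (trans (trans (∑-const (allVecs n) 1) (ℕₚ.*-identityʳ _)) (length-allVecs n))

  dim-E : dim E ≡ n
  dim-E = ^-injective q 1<q (trans (sym (card-subspace E E-isSubspace)) card-E)

  ⊆∧card≡⇒≡ : ∀ S V → (∀ v → χ S v ≡ true → χ V v ≡ true) → card S ≡ card V → S ≡ V
  ⊆∧card≡⇒≡ S V S⊆V eq = subset-ext S V (λ v → 𝟙-injective (∑-≤-tight (allVecs n) (λ w → 𝟙-mono (S⊆V w)) eq (vec∈ v)))

  ∈subspaces⇒isSubspace : ∀ {V} → V ∈ subspaces → IsSubspace V
  ∈subspaces⇒isSubspace V∈ = proj₂ (∈-filter⁻ _ {xs = allSubsets N} V∈)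

  χ-+ˢ : ∀ V W v → χ (V +ˢ W) v ≡ any (λ i → any (λ j → Vec.lookup V i ∧ Vec.lookup W j ∧ eqᵇ (vec i ⊕ vec j) v) indices) indices
  χ-+ˢ V W v = trans (Vecₚ.lookup∘tabulate _ (idx v))
    (cong (λ w → any (λ i → any (λ j → Vec.lookup V i ∧ Vec.lookup W j ∧ eqᵇ (vec i ⊕ vec j) w) indices) indices) (vec∘idx v))

  ∈-+ˢ⁺ : ∀ V W {u w} → χ V u ≡ true → χ W w ≡ true → χ (V +ˢ W) (u ⊕ w) ≡ true
  ∈-+ˢ⁺ V W {u} {w} Vu Ww = trans (χ-+ˢ V W (u ⊕ w))
    (any-true _ indices (∈-allFin (idx u)) (any-true _ indices (∈-allFin (idx w))
      (cong₂ _∧_ Vu (cong₂ _∧_ Ww (trans (cong₂ (λ a b → eqᵇ (a ⊕ b) (u ⊕ w)) (vec∘idx u) (vec∘idx w)) (eqᵇ-refl (u ⊕ w)))))))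

  ∈-+ˢ⁻ : ∀ V W v → χ (V +ˢ W) v ≡ true → ∃ λ u → ∃ λ w → χ V u ≡ true × χ W w ≡ true × u ⊕ w ≡ v
  ∈-+ˢ⁻ V W v v∈ with any-witness _ indices (trans (sym (χ-+ˢ V W v)) v∈)
  ... | i , _ , found with any-witness _ indices found
  ...   | j , _ , Vi∧Wj∧eq =
    vec i , vec j , trans (χ-vec V i) (Boolₚ.∧-conicalˡ _ _ Vi∧Wj∧eq) , trans (χ-vec W j) (Boolₚ.∧-conicalˡ _ _ Wj∧eq) ,
    eqᵇ⇒≡ _ _ (Boolₚ.∧-conicalʳ (Vec.lookup W j) _ Wj∧eq)
    where Wj∧eq = Boolₚ.∧-conicalʳ (Vec.lookup V i) _ Vi∧Wj∧eq

  span-+ˢ-span : ∀ {m} x (ts : Vec Vect m) → span ts +ˢ span (x ∷ []) ≡ span (x ∷ ts)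
  span-+ˢ-span x ts = subset-ext _ _ (λ v → trans (true-ext (sum⇒span v) (span⇒sum v)) (sym (χ-span (x ∷ ts) v)))
    where
    sum⇒span : ∀ v → χ (span ts +ˢ span (x ∷ [])) v ≡ true → inSpan (x ∷ ts) v ≡ true
    sum⇒span v v∈ with ∈-+ˢ⁻ (span ts) (span (x ∷ [])) v v∈
    ... | u , w , u∈ , w∈ , refl with span⇒lincomb ts u (trans (sym (χ-span ts u)) u∈)
                                     | span⇒lincomb (x ∷ []) w (trans (sym (χ-span (x ∷ []) w)) w∈)
    ...   | cs , refl | c ∷ [] , refl =
      lincomb∈span (x ∷ ts) (c ∷ cs) (trans (cong (_⊕ lincomb cs ts) (sym (⊕-identityʳ (c ⊙ x)))) (⊕-comm _ _))
    span⇒sum : ∀ v → inSpan (x ∷ ts) v ≡ true → χ (span ts +ˢ span (x ∷ [])) v ≡ true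
    span⇒sum v v∈ with span⇒lincomb (x ∷ ts) v v∈
    ... | c ∷ cs , refl = subst (λ w → χ (span ts +ˢ span (x ∷ [])) w ≡ true)
                            (trans (⊕-comm _ _) (cong (_⊕ lincomb cs ts) (⊕-identityʳ (c ⊙ x))))
                            (∈-+ˢ⁺ (span ts) (span (x ∷ []))
                              (trans (χ-span ts _) (lincomb∈span ts cs refl))
                              (trans (χ-span (x ∷ []) _) (lincomb∈span (x ∷ []) (c ∷ []) refl)))

  outside-or-E : ∀ V → (∃ λ x → χ V x ≡ false) ⊎ V ≡ E
  outside-or-E V with any (not ∘ χ V) (allVecs n) in found
  ... | true with any-witness (not ∘ χ V) (allVecs n) found
  ...   | x , _ , ¬Vx = inj₁ (x , Boolₚ.not-injective ¬Vx)
  outside-or-E V | false = inj₂ (subset-ext V E (λ v → trans (everywhere v) (sym (χ-E v))))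
    where
    everywhere : ∀ v → χ V v ≡ true
    everywhere v = Boolₚ.¬-not (λ ¬Vv → Boolₚ.not-¬ found (any-true (not ∘ χ V) (allVecs n) (vec∈ v) (cong not ¬Vv)))

  module _ (V : Subset N) (isV : IsSubspace V) (x : Vect) (x∉V : χ V x ≡ false) where

    private
      B : Vec Vect (dim V)
      B = Vec.fromList (basis V)

    +ˢ-span≡span-∷-basis : V +ˢ span (x ∷ []) ≡ span (x ∷ B)
    +ˢ-span≡span-∷-basis = trans (cong (_+ˢ span (x ∷ [])) (sym (span-basis V isV))) (span-+ˢ-span x B)

    +ˢ-span-isSubspace : IsSubspace (V +ˢ span (x ∷ []))
    +ˢ-span-isSubspace = subst IsSubspace (sym +ˢ-span≡span-∷-basis) (span-isSubspace (x ∷ B))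

    dim-+ˢ-span : dim (V +ˢ span (x ∷ [])) ≡ suc (dim V)
    dim-+ˢ-span = trans (cong dim +ˢ-span≡span-∷-basis) (dim-span (x ∷ B)
      (independent-∷ x B (independent (basis-invariant V)) (trans (sym (χ-span B x)) (trans (cong (λ S → χ S x) (span-basis V isV)) x∉V))))

    dim-span-outside : dim (span (x ∷ [])) ≡ 1
    dim-span-outside = dim-span (x ∷ []) (independent-∷ x [] independent-[] (Boolₚ.¬-not x∉span[]))
      where
      x∉span[] : inSpan [] x ≢ true
      x∉span[] x∈ with span⇒lincomb [] x x∈
      ... | [] , refl = Boolₚ.not-¬ x∉V (zero-closed (isSubspace⇒closed V isV))

module SubspaceCount (F : FiniteField) (n : ℕ) where
  open FiniteField F
  open Space F n
  open Vectors F n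
  open Subspaces F n
  open ≡-Reasoning

  IndependentTuple : ℕ → Set
  IndependentTuple d = Σ (Vec Vect d) Independent

  extensionsBy : ∀ {d} (t : IndependentTuple d) v b → inSpan (proj₁ t) v ≡ b → List (IndependentTuple (suc d))
  extensionsBy _           _ true  _  = []
  extensionsBy (t , indep) v false v∉ = (v ∷ t , independent-∷ v t indep v∉) ∷ []

  extensions : ∀ {d} → IndependentTuple d → Vect → List (IndependentTuple (suc d))
  extensions t v = extensionsBy t v (inSpan (proj₁ t) v) refl

  ∑-extensions : ∀ {d} (t : IndependentTuple d) v (f : Vec Vect (suc d) → ℕ) →
                 ℕΣ.∑ (extensions t v) (f ∘ proj₁) ≡ (if inSpan (proj₁ t) v then 0 else f (v ∷ proj₁ t))
  ∑-extensions t v f = by-cases (inSpan (proj₁ t) v) refl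
    where
    by-cases : ∀ b (eq : inSpan (proj₁ t) v ≡ b) →
               ℕΣ.∑ (extensionsBy t v b eq) (f ∘ proj₁) ≡ (if b then 0 else f (v ∷ proj₁ t))
    by-cases true  _ = refl
    by-cases false _ = ℕₚ.+-identityʳ _

  independentTuples : (d : ℕ) → List (IndependentTuple d)
  independentTuples zero    = ([] , independent-[]) ∷ []
  independentTuples (suc d) = concatMap (λ t → concatMap (extensions t) (allVecs n)) (independentTuples d)

  tuplesIn : ℕ → Subset N → ℕ
  tuplesIn d V = ℕΣ.∑ (independentTuples d) (λ t → 𝟙 (AllIn (χ V) (proj₁ t)))

  card-outside-span : ∀ {d} (t : Vec Vect d) → Independent t → ∀ V → IsSubspace V → AllIn (χ V) t ≡ true →
                      ℕΣ.∑ (allVecs n) (λ v → if inSpan t v then 0 else 𝟙 (χ V v)) ≡ card V ∸ q ^ d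
  card-outside-span {d} t indep V isV t⊆V = sym (begin
    card V ∸ q ^ d                                                   ≡⟨ cong (_∸ q ^ d) split ⟩
    card (span t) ℕ.+ outside ∸ q ^ d                                ≡⟨ cong (λ c → c ℕ.+ outside ∸ q ^ d) (card-span t indep) ⟩
    q ^ d ℕ.+ outside ∸ q ^ d                                        ≡⟨ ℕₚ.m+n∸m≡n (q ^ d) outside ⟩
    outside                                                          ∎)
    where
    outside = ℕΣ.∑ (allVecs n) (λ v → if inSpan t v then 0 else 𝟙 (χ V v))
    span⊆V : ∀ v → inSpan t v ≡ true → χ V v ≡ true
    span⊆V = span-minimal (isSubspace⇒closed V isV) t t⊆V
    pointwise : ∀ v → 𝟙 (χ V v) ≡ 𝟙 (χ (span t) v) ℕ.+ (if inSpan t v then 0 else 𝟙 (χ V v))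
    pointwise v rewrite χ-span t v with inSpan t v in v∈
    ... | true rewrite span⊆V v v∈ = refl
    ... | false = refl
    split : card V ≡ card (span t) ℕ.+ outside
    split = trans (ℕΣ.∑-cong (allVecs n) pointwise) (ℕΣ.∑-distrib (allVecs n) _ _)

  tuplesIn-suc : ∀ d V → IsSubspace V → tuplesIn (suc d) V ≡ tuplesIn d V ℕ.* (card V ∸ q ^ d)
  tuplesIn-suc d V isV = begin
    tuplesIn (suc d) V
      ≡⟨ ℕΣ.∑-concatMap _ (independentTuples d) _ ⟩
    ℕΣ.∑ (independentTuples d) (λ t → ℕΣ.∑ (concatMap (extensions t) (allVecs n)) in-V)
      ≡⟨ ℕΣ.∑-cong (independentTuples d) (λ t → ℕΣ.∑-concatMap (extensions t) (allVecs n) in-V) ⟩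
    ℕΣ.∑ (independentTuples d) (λ t → ℕΣ.∑ (allVecs n) (λ v → ℕΣ.∑ (extensions t v) in-V))
      ≡⟨ ℕΣ.∑-cong (independentTuples d) (λ t → ℕΣ.∑-cong (allVecs n) (λ v → ∑-extensions t v (𝟙 ∘ AllIn (χ V)))) ⟩
    ℕΣ.∑ (independentTuples d) (λ (t , _) → ℕΣ.∑ (allVecs n) (λ v → if inSpan t v then 0 else 𝟙 (χ V v ∧ AllIn (χ V) t)))
      ≡⟨ ℕΣ.∑-cong (independentTuples d) (λ (t , indep) → per-tuple t indep) ⟩
    ℕΣ.∑ (independentTuples d) (λ t → in-V t ℕ.* (card V ∸ q ^ d))
      ≡⟨ sym (ℕΣ.∑-distribʳ (independentTuples d) in-V _) ⟩
    tuplesIn d V ℕ.* (card V ∸ q ^ d) ∎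
    where
    in-V : ∀ {k} → IndependentTuple k → ℕ
    in-V t = 𝟙 (AllIn (χ V) (proj₁ t))
    per-tuple : ∀ t → Independent t →
                ℕΣ.∑ (allVecs n) (λ v → if inSpan t v then 0 else 𝟙 (χ V v ∧ AllIn (χ V) t))
                  ≡ 𝟙 (AllIn (χ V) t) ℕ.* (card V ∸ q ^ d)
    per-tuple t indep with AllIn (χ V) t in t⊆V
    ... | true  = trans (ℕΣ.∑-cong (allVecs n) (λ v → cong (λ b → if inSpan t v then 0 else 𝟙 b) (Boolₚ.∧-identityʳ (χ V v))))
                        (trans (card-outside-span t indep V isV t⊆V) (sym (ℕₚ.+-identityʳ _)))
    ... | false = ℕΣ.∑-zero-∈ (allVecs n) (λ {v} _ → vanish (inSpan t v) (χ V v))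
      where vanish : ∀ b c → (if b then 0 else 𝟙 (c ∧ false)) ≡ 0
            vanish true  _     = refl
            vanish false true  = refl
            vanish false false = refl

  tuplesIn≡qFalling : ∀ d V → IsSubspace V → tuplesIn d V ≡ qFalling q (card V) d
  tuplesIn≡qFalling zero    V isV = refl
  tuplesIn≡qFalling (suc d) V isV = trans (tuplesIn-suc d V isV) (cong (ℕ._* (card V ∸ q ^ d)) (tuplesIn≡qFalling d V isV))

  module Subsets (m : ℕ) = Enumeration (Vecₚ.≡-dec {n = m} Bool._≟_)

  allSubsets-enumerates : ∀ m → Subsets.Enumerates m (allSubsets m)
  allSubsets-enumerates zero    []      = refl
  allSubsets-enumerates (suc m) (b ∷ S) =
    trans (ℕΣ.∑-concatMap _ (allSubsets m) _) (trans (ℕΣ.∑-cong (allSubsets m) (once b)) (allSubsets-enumerates m S))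
    where
    once : ∀ b s → 𝟙 (does (Vecₚ.≡-dec Bool._≟_ (b ∷ S) (true ∷ s))) ℕ.+ (𝟙 (does (Vecₚ.≡-dec Bool._≟_ (b ∷ S) (false ∷ s))) ℕ.+ 0)
                 ≡ 𝟙 (does (Vecₚ.≡-dec Bool._≟_ S s))
    once true  s with does (Vecₚ.≡-dec Bool._≟_ S s)
    ... | true  = refl
    ... | false = refl
    once false s with does (Vecₚ.≡-dec Bool._≟_ S s)
    ... | true  = refl
    ... | false = refl

  subspacesOfDim : ℕ → List (Subset N)
  subspacesOfDim d = filter (λ V → dim V ℕ.≟ d) subspaces

  count-span : ∀ {d} (t : Vec Vect d) → Independent t → Subsets.count N (span t) (subspacesOfDim d) ≡ 1
  count-span {d} t indep = begin
    Subsets.count N (span t) (subspacesOfDim d) ≡⟨ Subsets.count-filter N (λ V → dim V ℕ.≟ d) subspaces {span t} (dim-span t indep) ⟩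
    Subsets.count N (span t) subspaces          ≡⟨ Subsets.count-filter N _ (allSubsets N) {span t} (span-isSubspace t) ⟩
    Subsets.count N (span t) (allSubsets N)     ≡⟨ allSubsets-enumerates N (span t) ⟩
    1                                           ∎

  span≡?-AllIn : ∀ {d} (t : Vec Vect d) → Independent t → ∀ V → IsSubspace V → dim V ≡ d →
                 does (Vecₚ.≡-dec Bool._≟_ (span t) V) ≡ AllIn (χ V) t
  span≡?-AllIn {d} t indep V isV dimV≡d = true-ext span≡V⇒t⊆V t⊆V⇒span≡V
    where
    span≡V⇒t⊆V : does (Vecₚ.≡-dec Bool._≟_ (span t) V) ≡ true → AllIn (χ V) t ≡ true
    span≡V⇒t⊆V eq with Vecₚ.≡-dec Bool._≟_ (span t) V
    ... | yes refl = AllIn-mono (λ v v∈ → trans (χ-span t v) v∈) t (AllIn-span t)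
    t⊆V⇒span≡V : AllIn (χ V) t ≡ true → does (Vecₚ.≡-dec Bool._≟_ (span t) V) ≡ true
    t⊆V⇒span≡V t⊆V = dec-true (Vecₚ.≡-dec Bool._≟_ (span t) V) (⊆∧card≡⇒≡ (span t) V
      (λ v v∈ → span-minimal (isSubspace⇒closed V isV) t t⊆V v (trans (sym (χ-span t v)) v∈))
      (trans (card-span t indep) (trans (cong (q ^_) (sym dimV≡d)) (sym (card-subspace V isV)))))

  qFalling-double-count : ∀ d → qFalling q (q ^ n) d ≡ length (subspacesOfDim d) ℕ.* qFalling q (q ^ d) d
  qFalling-double-count d = begin
    qFalling q (q ^ n) d
      ≡⟨ cong (λ c → qFalling q c d) (sym card-E) ⟩
    qFalling q (card E) d
      ≡⟨ sym (tuplesIn≡qFalling d E E-isSubspace) ⟩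
    tuplesIn d E
      ≡⟨ ℕΣ.∑-cong (independentTuples d) (λ (t , indep) → trans (cong 𝟙 (AllIn-const χ-E t)) (sym (count-span t indep))) ⟩
    ℕΣ.∑ (independentTuples d) (λ (t , _) → Subsets.count N (span t) (subspacesOfDim d))
      ≡⟨ ℕΣ.∑-comm (independentTuples d) (subspacesOfDim d) _ ⟩
    ℕΣ.∑ (subspacesOfDim d) (λ V → ℕΣ.∑ (independentTuples d) (λ (t , _) → 𝟙 (does (Vecₚ.≡-dec Bool._≟_ (span t) V))))
      ≡⟨ ℕΣ.∑-cong-∈ (subspacesOfDim d) tuples-spanning ⟩
    ℕΣ.∑ (subspacesOfDim d) (const (qFalling q (q ^ d) d))
      ≡⟨ ∑-const (subspacesOfDim d) _ ⟩
    length (subspacesOfDim d) ℕ.* qFalling q (q ^ d) d ∎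
    where
    tuples-spanning : ∀ {V} → V ∈ subspacesOfDim d →
                      ℕΣ.∑ (independentTuples d) (λ (t , _) → 𝟙 (does (Vecₚ.≡-dec Bool._≟_ (span t) V))) ≡ qFalling q (q ^ d) d
    tuples-spanning {V} V∈ with V∈subspaces , dimV≡d ← ∈-filter⁻ (λ V → dim V ℕ.≟ d) {xs = subspaces} V∈ = begin
      ℕΣ.∑ (independentTuples d) (λ (t , _) → 𝟙 (does (Vecₚ.≡-dec Bool._≟_ (span t) V)))
        ≡⟨ ℕΣ.∑-cong (independentTuples d) (λ (t , indep) → cong 𝟙 (span≡?-AllIn t indep V isV dimV≡d)) ⟩
      tuplesIn d V
        ≡⟨ tuplesIn≡qFalling d V isV ⟩
      qFalling q (card V) d
        ≡⟨ cong (λ c → qFalling q c d) (trans (card-subspace V isV) (cong (q ^_) dimV≡d)) ⟩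
      qFalling q (q ^ d) d ∎
      where isV = ∈subspaces⇒isSubspace V∈subspaces

  #subspacesOfDim : ∀ d → length (subspacesOfDim d) ≡ gauss q n d
  #subspacesOfDim d = GaussianProduct.gauss-unique q {{ℕ.>-nonZero (ℕₚ.<-trans (s≤s z≤n) 1<q)}} 1<q n d _ (qFalling-double-count d)

module QMatroidBounds {F : FiniteField} {n : ℕ} (M : QMatroid F n) where
  open Space F n
  open Vectors F n
  open Subspaces F n
  open QMatroid M
  open import Data.Nat using (_+_)

  ρ≤rank : ∀ V → IsSubspace V → ρ V ≤ rank
  ρ≤rank V isV = ρ-mono V E isV E-isSubspace (λ _ → ∈⊤)

  ρ-+ˢ-span : ∀ V → IsSubspace V → ∀ x → χ V x ≡ false → ρ (V +ˢ span (x ∷ [])) ≤ suc (ρ V)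
  ρ-+ˢ-span V isV x x∉V = begin
    ρ (V +ˢ W)                   ≤⟨ ℕₚ.m≤m+n (ρ (V +ˢ W)) (ρ (V ∩ W)) ⟩
    ρ (V +ˢ W) + ρ (V ∩ W)       ≤⟨ ρ-submod V W isV (span-isSubspace (x ∷ [])) ⟩
    ρ V + ρ W                    ≤⟨ ℕₚ.+-monoʳ-≤ (ρ V) (ρ-le-dim W (span-isSubspace (x ∷ []))) ⟩
    ρ V + dim W                  ≡⟨ cong (ρ V +_) (dim-span-outside V isV x x∉V) ⟩
    ρ V + 1                      ≡⟨ ℕₚ.+-comm (ρ V) 1 ⟩
    suc (ρ V)                    ∎
    where
    open ℕₚ.≤-Reasoning
    W = span (x ∷ [])

  dim+rank≤n+ρ : ∀ V → IsSubspace V → dim V + rank ≤ n + ρ V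
  dim+rank≤n+ρ V isV = by-codim (n ∸ dim V) V isV (ℕₚ.m+[n∸m]≡n (dim≤n V isV))
    where
    by-codim : ∀ t V → IsSubspace V → dim V + t ≡ n → dim V + rank ≤ n + ρ V
    by-codim t V isV _ with outside-or-E V
    by-codim t       V isV _  | inj₂ refl = ℕₚ.≤-reflexive (cong (_+ rank) dim-E)
    by-codim zero    V isV eq | inj₁ (x , x∉V) = ⊥-elim (ℕₚ.n≮n (dim V)
      (subst₂ _≤_ (dim-+ˢ-span V isV x x∉V) (trans (sym eq) (ℕₚ.+-identityʳ (dim V)))
              (dim≤n (V +ˢ span (x ∷ [])) (+ˢ-span-isSubspace V isV x x∉V))))
    by-codim (suc t) V isV eq | inj₁ (x , x∉V) = ℕₚ.≤-pred (begin
      suc (dim V + rank)                  ≡⟨ cong (_+ rank) (sym (dim-+ˢ-span V isV x x∉V)) ⟩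
      dim V′ + rank                       ≤⟨ by-codim t V′ (+ˢ-span-isSubspace V isV x x∉V) codim ⟩
      n + ρ V′                            ≤⟨ ℕₚ.+-monoʳ-≤ n (ρ-+ˢ-span V isV x x∉V) ⟩
      n + suc (ρ V)                       ≡⟨ ℕₚ.+-suc n (ρ V) ⟩
      suc (n + ρ V)                       ∎)
      where
      open ℕₚ.≤-Reasoning
      V′ = V +ˢ span (x ∷ [])
      codim : dim V′ + t ≡ n
      codim = trans (cong (_+ t) (dim-+ˢ-span V isV x x∉V)) (trans (sym (ℕₚ.+-suc (dim V) t)) eq)

module WhitneySum {F : FiniteField} {n : ℕ} (M : QMatroid F n) (ℓ : ℕ) where
  open FiniteField F using (q)
  open Space F n
  open Vectors F n
  open Subspaces F n
  open QMatroid M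
  open QMatroidBounds M
  open import Data.Integer using (+_; _*_)
  open import Data.Nat using (_+_)
  open ≡-Reasoning

  h : ℕ → ℤ
  h s = summand q s ℓ

  contributes : ℕ → ℕ → Subset N → Bool
  contributes a c V = does (ρ V ℕ.≟ rank ∸ a) ∧ does (dim V ℕ.≟ rank ∸ a + c)

  term : ℕ → ℕ → Subset N → ℤ
  term a c V = + 𝟙 (contributes a c V) * h (rank + c ∸ a)

  ν-term≡∑ : ∀ a c → + ν a c * h (rank + c ∸ a) ≡ ℤΣ.∑ subspaces (term a c)
  ν-term≡∑ a c = begin
    + ν a c * h (rank + c ∸ a)                                        ≡⟨ cong (λ k → + k * h (rank + c ∸ a)) (length-filter≡∑ _ subspaces) ⟩
    + ℕΣ.∑ subspaces (𝟙 ∘ contributes a c) * h (rank + c ∸ a)         ≡⟨ cong (_* h (rank + c ∸ a)) (+-∑ subspaces _) ⟩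
    ℤΣ.∑ subspaces (λ V → + 𝟙 (contributes a c V)) * h (rank + c ∸ a) ≡⟨ ℤΣ.∑-distribʳ subspaces _ _ ⟩
    ℤΣ.∑ subspaces (term a c)                                         ∎

  contribution : ∀ V → IsSubspace V →
                 ℤΣ.∑ (upTo (suc rank)) (λ a → ℤΣ.∑ (upTo (suc (n ∸ rank))) (λ c → term a c V)) ≡ h (dim V)
  contribution V isV = begin
    ℤΣ.∑ (upTo (suc rank)) (λ a → ℤΣ.∑ (upTo (suc (n ∸ rank))) (λ c → term a c V))
      ≡⟨ ℤΣ.∑-single (upTo⁺ _) (∈-upTo⁺ (s≤s (ℕₚ.m∸n≤m rank (ρ V)))) other-a ⟩
    ℤΣ.∑ (upTo (suc (n ∸ rank))) (λ c → term a₀ c V)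
      ≡⟨ ℤΣ.∑-single (upTo⁺ _) (∈-upTo⁺ (s≤s c₀≤n∸rank)) other-c ⟩
    term a₀ c₀ V
      ≡⟨ cong₂ (λ b b′ → + 𝟙 (b ∧ b′) * h (rank + c₀ ∸ a₀))
               (dec-true (ρ V ℕ.≟ rank ∸ a₀) (sym rank∸a₀≡ρ))
               (dec-true (dim V ℕ.≟ rank ∸ a₀ + c₀) (sym (trans (cong (_+ c₀) rank∸a₀≡ρ) (ℕₚ.m+[n∸m]≡n ρ≤dim)))) ⟩
    + 1 * h (rank + c₀ ∸ a₀)
      ≡⟨ ℤₚ.*-identityˡ _ ⟩
    h (rank + c₀ ∸ a₀)
      ≡⟨ cong h (k+[m∸o]∸[k∸o]≡m ρ≤rank′ ρ≤dim) ⟩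
    h (dim V) ∎
    where
    a₀ c₀ : ℕ
    a₀ = rank ∸ ρ V
    c₀ = dim V ∸ ρ V
    ρ≤rank′ = ρ≤rank V isV
    ρ≤dim   = ρ-le-dim V isV
    rank∸a₀≡ρ : rank ∸ a₀ ≡ ρ V
    rank∸a₀≡ρ = ℕₚ.m∸[m∸n]≡n ρ≤rank′
    c₀≤n∸rank : c₀ ≤ n ∸ rank
    c₀≤n∸rank = m+p≤n+o⇒m∸o≤n∸p ρ≤dim (dim+rank≤n+ρ V isV)
    other-a : ∀ {a} → a ∈ upTo (suc rank) → a ≢ a₀ → ℤΣ.∑ (upTo (suc (n ∸ rank))) (λ c → term a c V) ≡ + 0
    other-a {a} a∈ a≢a₀ = ℤΣ.∑-zero-∈ (upTo (suc (n ∸ rank))) (λ {c} _ →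
      cong (λ b → + 𝟙 (b ∧ does (dim V ℕ.≟ rank ∸ a + c)) * h (rank + c ∸ a))
           (dec-false (ρ V ℕ.≟ rank ∸ a)
             (λ ρ≡ → a≢a₀ (ℕₚ.∸-cancelˡ-≡ (ℕₚ.≤-pred (∈-upTo⁻ a∈)) (ℕₚ.m∸n≤m rank (ρ V)) (trans (sym ρ≡) (sym rank∸a₀≡ρ))))))
    other-c : ∀ {c} → c ∈ upTo (suc (n ∸ rank)) → c ≢ c₀ → term a₀ c V ≡ + 0
    other-c {c} _ c≢c₀ = cong (λ b → + 𝟙 b * h (rank + c ∸ a₀))
      (trans (cong (does (ρ V ℕ.≟ rank ∸ a₀) ∧_)
                   (dec-false (dim V ℕ.≟ rank ∸ a₀ + c)
                     (λ dim≡ → c≢c₀ (sym (trans (cong (_∸ ρ V) (trans dim≡ (cong (_+ c) rank∸a₀≡ρ))) (ℕₚ.m+n∸m≡n (ρ V) c))))))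
             (Boolₚ.∧-zeroʳ _))

  whitney-sum≡∑-subspaces : sumℤ rank (λ a → sumℤ (n ∸ rank) (λ c → + ν a c * h (rank + c ∸ a))) ≡ ℤΣ.∑ subspaces (h ∘ dim)
  whitney-sum≡∑-subspaces = begin
    ℤΣ.∑ (upTo (suc rank)) (λ a → ℤΣ.∑ (upTo (suc (n ∸ rank))) (λ c → + ν a c * h (rank + c ∸ a)))
      ≡⟨ ℤΣ.∑-cong (upTo (suc rank)) (λ a → ℤΣ.∑-cong (upTo (suc (n ∸ rank))) (ν-term≡∑ a)) ⟩
    ℤΣ.∑ (upTo (suc rank)) (λ a → ℤΣ.∑ (upTo (suc (n ∸ rank))) (λ c → ℤΣ.∑ subspaces (term a c)))
      ≡⟨ ℤΣ.∑-cong (upTo (suc rank)) (λ a → ℤΣ.∑-comm (upTo (suc (n ∸ rank))) subspaces (term a)) ⟩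
    ℤΣ.∑ (upTo (suc rank)) (λ a → ℤΣ.∑ subspaces (λ V → ℤΣ.∑ (upTo (suc (n ∸ rank))) (λ c → term a c V)))
      ≡⟨ ℤΣ.∑-comm (upTo (suc rank)) subspaces _ ⟩
    ℤΣ.∑ subspaces (λ V → ℤΣ.∑ (upTo (suc rank)) (λ a → ℤΣ.∑ (upTo (suc (n ∸ rank))) (λ c → term a c V)))
      ≡⟨ ℤΣ.∑-cong-∈ subspaces (λ {V} V∈ → contribution V (∈subspaces⇒isSubspace V∈)) ⟩
    ℤΣ.∑ subspaces (h ∘ dim) ∎

open import Data.Nat using (_+_)
open import Data.Integer using (_*_; +_)

corollary4p12 : (F : FiniteField) (n : ℕ) (M : QMatroid F n) (ℓ : ℕ) → ℓ ≤ n →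
    sumℤ (QMatroid.rank M) (λ a → sumℤ (n ∸ QMatroid.rank M) (λ c →
        + QMatroid.ν M a c * summand (FiniteField.q F) (QMatroid.rank M + c ∸ a) ℓ))
      ≡ δ ℓ n
corollary4p12 F n M ℓ _ = begin
  sumℤ rank (λ a → sumℤ (n ∸ rank) (λ c → + ν a c * h (rank + c ∸ a)))
    ≡⟨ whitney-sum≡∑-subspaces ⟩
  ℤΣ.∑ subspaces (h ∘ dim)
    ≡⟨ ∑-by-fibres subspaces dim h (suc n) (λ {V} V∈ → s≤s (dim≤n V (∈subspaces⇒isSubspace V∈))) ⟩
  ℤΣ.∑ (upTo (suc n)) (λ d → + length (subspacesOfDim d) * h d)
    ≡⟨ ℤΣ.∑-cong (upTo (suc n)) (λ d → cong (λ k → + k * h d) (#subspacesOfDim d)) ⟩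
  ℤΣ.∑ (upTo (suc n)) (λ d → + gauss q n d * h d)
    ≡⟨ QBinomialInversion.gauss-inversion q n ℓ ⟩
  δ ℓ n ∎
  where
  open FiniteField F using (q)
  open Space F n
  open Vectors F n
  open Subspaces F n
  open SubspaceCount F n
  open QMatroid M
  open WhitneySum M ℓ
  open ≡-Reasoning
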